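{- Let $X,Y$ be finite sets and let $E\subseteq X\times Y$ have VC dimension at most $d$, where $d\geq 2$, and let $r\geq 2$. Then there is a $1/r$-regular partition $\mathcal{P}$ of $(X,Y)$ with \[|\mathcal{P}|\leq O\Big(\big(d r^3\ln r^3\big)^{d^{2\cdot 10^3 r^7}}\Big).\]
   Context: Notation: for $x\in X$, $E_x=\{y\mid (x,y)\in E\}$; for $y\in Y$, $E^y=\{x\mid (x,y)\in E\}$. $\mu$ denotes normalized counting measure: $\mu(X')=|X'|/|X|$ for $X'\subseteq X$, $\mu(Y')=|Y'|/|Y|$ for $Y'\subseteq Y$, $\mu(S)=|S|/(|X||Y|)$ for $S\subseteq X\times Y$. Density: $d(X',Y')=\mu(E\cap(X'\times Y'))/(\mu(X')\mu(Y'))$. VC dimension: a family $\{E_x\}_{x\in X}$ shatters $I\subseteq Y$ if every $J\subseteq I$ equals $E_x\cap I$ for some $x$; its VC dimension is the sup of sizes of shattered sets. The VC dimension of $E$ is the larger of the VC dimensions of $\{E_x\}_{x\in X}$ and of $\{E^y\}_{y\in Y}$. A partition $\mathcal{P}$ is a pair $(\{X_i\}_{i\leq n},\{Y_j\}_{j\leq m})$ where $\{X_i\}$ is a partition of $X$ and $\{Y_j\}$ a partition of $Y$ (into nonempty pieces); $|\mathcal{P}|=\max\{n,m\}$. A pair $(X_i,Y_j)$ is $\epsilon$-regular if whenever $X'\subseteq X_i$, $Y'\subseteq Y_j$ with $\mu(X')\geq\epsilon\mu(X_i)$ and $\mu(Y')\geq\epsilon\mu(Y_j)$, we have $|d(X_i,Y_j)-d(X',Y')|<\epsilon$.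 The partition $\mathcal{P}$ is $\epsilon$-regular if the sum of $\mu(X_i)\mu(Y_j)$ over all pairs $(i,j)$ with $(X_i,Y_j)$ not $\epsilon$-regular is $<\epsilon$. $O(\cdot)$ denotes a bound up to an absolute constant independent of $X,Y,E,d,r$. -}

module Defs where

open import Data.Nat as ℕ using (ℕ; zero; suc; _⊔_)
open import Data.Nat.Base using (_!)
open import Data.Bool using (Bool; true; false; _∧_; if_then_else_)
open import Data.Fin using (Fin; zero; suc)
open import Data.Fin.Subset using (Subset; _⊆_; ∣_∣)
open import Data.Vec using (lookup; tabulate)
open import Data.Integer using (+_)
open import Data.Rational using (ℚ; 0ℚ; 1ℚ; _/_; _+_; _*_; _-_; _≤_; _<_) renaming (∣_∣ to absℚ)
open import Data.Product using (Σ; ∃; ∃-syntax; _×_)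
open import Relation.Binary.PropositionalEquality using (_≡_)
open import Relation.Nullary.Decidable using (⌊_⌋)
open import Data.Fin using (_≟_)

-- a / b as a rational; the value for b = 0 is an (unused) dummy 0.
frac : ℕ → ℕ → ℚ
frac a zero    = 0ℚ
frac a (suc b) = (+ a) / suc b

sumFin : ∀ {n} → (Fin n → ℕ) → ℕ
sumFin {zero}  f = 0
sumFin {suc n} f = f zero ℕ.+ sumFin (λ i → f (suc i))

sumFinℚ : ∀ {n} → (Fin n → ℚ) → ℚ
sumFinℚ {zero}  f = 0ℚ
sumFinℚ {suc n} f = f zero + sumFinℚ (λ i → f (suc i))

_^ℚ_ : ℚ → ℕ → ℚ
q ^ℚ zero  = 1ℚ
q ^ℚ suc k = q * (q ^ℚ k)

-- Setting: X = Fin n, Y = Fin m, E ⊆ X × Y given by its indicator.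

Rel : ℕ → ℕ → Set
Rel n m = Fin n → Fin m → Bool

μ : ∀ {n} → Subset n → ℚ
μ {n} A = frac ∣ A ∣ n

edgeCount : ∀ {n m} → Rel n m → Subset n → Subset m → ℕ
edgeCount E A B =
  sumFin (λ x → sumFin (λ y → if (lookup A x ∧ lookup B y ∧ E x y) then 1 else 0))

-- d(X',Y') = μ(E ∩ (X'×Y')) / (μ(X') μ(Y')) = |E ∩ X'×Y'| / (|X'| |Y'|)
-- (the normalising factors |X||Y| cancel; the value when X' or Y' is empty
--  is never used)
density : ∀ {n m} → Rel n m → Subset n → Subset m → ℚ
density E A B = frac (edgeCount E A B) (∣ A ∣ ℕ.* ∣ B ∣)

Shatters : ∀ {n m} → Rel n m → Subset m → Set
Shatters F I = ∀ (J : Subset _) → J ⊆ I →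
  ∃[ x ] (∀ y → (F x y ∧ lookup I y) ≡ lookup J y)

FamilyVCDim≤ : ∀ {n m} → Rel n m → ℕ → Set
FamilyVCDim≤ F d = ∀ I → Shatters F I → ∣ I ∣ ℕ.≤ d

transposeRel : ∀ {n m} → Rel n m → Rel m n
transposeRel E y x = E x y

VCDim≤ : ∀ {n m} → Rel n m → ℕ → Set
VCDim≤ E d = FamilyVCDim≤ E d × FamilyVCDim≤ (transposeRel E) d

record Partition (n : ℕ) : Set where
  field
    parts  : ℕ
    assign : Fin n → Fin parts
    nonempty : ∀ (i : Fin parts) → ∃[ x ] assign x ≡ i

open Partition public

piece : ∀ {n} (P : Partition n) → Fin (parts P) → Subset n
piece P i = tabulate (λ x → ⌊ assign P x ≟ i ⌋)

RegularPair : ∀ {n m} → ℚ → Rel n m → Subset n → Subset m → Set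
RegularPair ε E A B =
  ∀ (A' : Subset _) (B' : Subset _) → A' ⊆ A → B' ⊆ B →
  ε * μ A ≤ μ A' → ε * μ B ≤ μ B' →
  absℚ (density E A B - density E A' B') < ε

-- The sum of μ(X_i)μ(Y_j) over the non-ε-regular pairs is < ε; phrased as:
-- some set `bad` of index pairs contains all non-regular pairs and has
-- total weight < ε (equivalent, since the weights are nonnegative).
RegularPartition : ∀ {n m} → ℚ → Rel n m → Partition n → Partition m → Set
RegularPartition ε E PX PY =
  Σ (Fin (parts PX) → Fin (parts PY) → Bool) λ bad →
    (∀ i j → bad i j ≡ false → RegularPair ε E (piece PX i) (piece PY j)) ×
    (sumFinℚ (λ i → sumFinℚ (λ j →
       if bad i j then μ (piece PX i) * μ (piece PY j) else 0ℚ)) < ε)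

size : ∀ {n m} → Partition n → Partition m → ℕ
size PX PY = parts PX ⊔ parts PY

expPartial : ℚ → ℕ → ℚ
expPartial q zero    = 0ℚ
expPartial q (suc k) = expPartial q k + frac 1 (k !) * (q ^ℚ k)

-- q ≤ ln x  (for q ≥ 0 this is exp q ≤ x)
≤ln : ℚ → ℕ → Set
≤ln q x = ∀ k → expPartial q k ≤ frac x 1

expo : ℕ → ℕ → ℕ
expo d r = d ℕ.^ (2 ℕ.* (10 ℕ.^ 3) ℕ.* (r ℕ.^ 7))

-- N ≤ C · (d r³ ln(r³))^K  with K = expo d r, expressed as:
-- every rational q ≥ 0 with C·(d r³ q)^K < N satisfies q ≤ ln(r³).
-- (Since ln(r³) > 0 and t ↦ C(d r³ t)^K is continuous and increasing, this
--  is equivalent to the real inequality.)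
BoundedBy : ℕ → ℕ → ℕ → ℕ → Set
BoundedBy C d r N =
  ∀ (q : ℚ) → 0ℚ ≤ q →
    frac C 1 * ((frac (d ℕ.* r ℕ.^ 3) 1 * q) ^ℚ expo d r) < frac N 1 →
    ≤ln q (r ℕ.^ 3)

{-# OPTIONS --safe #-}
-- Cluster the rows of E greedily: every row differs from the centre of its cluster in at most
-- m/(t+1) columns, and any two centres differ in more. On a random s-tuple of columns two such
-- centres agree with probability below (t/(t+1))^s, so for s = t·4^q some tuple separates all of
-- them; their traces on it are then distinct members of a family of VC dimension ≤ d, and
-- Sauer–Shelah bounds the number of clusters by (s+1)^(d+1). Cluster the columns likewise. On a
-- block X_i × Y_j, E is close to the centre row of X_i and, by the same count, to the centre
-- column of Y_j; comparing the two shows that all but a 1/r fraction of the weight lies in blocks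
-- where E is nearly constant, and nearly constant blocks are 1/r-regular. With t = 6r⁴ the rest is
-- arithmetic: (s+1)^(d+1) ≤ 2^(d^(2000 r⁷)), and 2 ≤ d·r³·ln r³.

module Submission where

open import Defs
open import Data.Nat as ℕ using (ℕ; zero; suc; _+_; _*_; _^_; _≤_; _<_; _≤?_; z≤n; s≤s)
open import Data.Nat.Properties
open import Data.Nat.Base using (_!)
open import Data.Nat.Tactic.RingSolver using (solve-∀)
import Data.Integer as ℤ
import Data.Integer.Properties as ℤ
open import Data.Rational as ℚ using (ℚ; 0ℚ; 1ℚ; toℚᵘ)
import Data.Rational.Properties as ℚ
import Data.Rational.Solver as ℚ-Solver
open import Data.Rational.Unnormalised as ℚᵘ using (mkℚᵘ; *≡*; *≤*; *<*)
import Data.Rational.Unnormalised.Properties as ℚᵘ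
open import Data.Bool using (Bool; true; false; _∧_; _∨_; not; _xor_; if_then_else_)
open import Data.Bool.Properties using (∧-zeroʳ; ∧-identityʳ; xor-same; xor-comm)
import Data.Bool.Properties as Bool
open import Data.Fin as Fin using (Fin; zero; suc)
import Data.Fin.Properties as Finₚ
open Finₚ using (any?)
open import Data.Fin.Subset using (Subset; ∣_∣; _⊆_; ⊥)
open import Data.Fin.Subset.Properties using (drop-∷-⊆; ∉⊥; p⊆q⇒∣p∣≤∣q∣; ∣p∣≤n)
open import Data.Vec using (_∷_; []; lookup; tabulate)
open import Data.Vec.Base using (here)
open import Data.Vec.Properties using (∷-injectiveʳ; lookup-replicate; lookup⇒[]=; []=⇒lookup; lookup∘tabulate; ≡-dec)
import Data.Vec.Functional as Vector
open Vector using (Vector)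
open import Data.List using (List; []; _∷_; allFin)
open import Data.List.Membership.Propositional using (_∈_)
open import Data.List.Membership.Propositional.Properties using (∈-allFin)
open import Data.List.Relation.Unary.Any using (here; there)
open import Data.Product using (Σ; ∃-syntax; _×_; _,_; proj₁; proj₂; map₂)
open import Data.Sum using (inj₁; inj₂)
open import Data.Empty using (⊥-elim)
open import Function using (_∘_)
open import Relation.Binary.PropositionalEquality
open import Relation.Binary.Definitions using (DecidableEquality)
import Relation.Binary.Definitions as B
open import Relation.Nullary using (¬_; contradiction)
open import Relation.Nullary.Decidable using (Dec; ⌊_⌋; yes; no; dec-true; isYes≗does)
open import Relation.Unary using (Pred; Decidable)

𝟙 : Bool → ℕ
𝟙 b = if b then 1 else 0

𝟙≤1 : ∀ b → 𝟙 b ≤ 1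
𝟙≤1 true  = ≤-refl
𝟙≤1 false = z≤n

𝟙-∧ : ∀ a b → 𝟙 (a ∧ b) ≡ 𝟙 a * 𝟙 b
𝟙-∧ true  b = sym (+-identityʳ (𝟙 b))
𝟙-∧ false b = refl

⌊⌋≡true : ∀ {p} {P : Set p} (P? : Dec P) → P → ⌊ P? ⌋ ≡ true
⌊⌋≡true P? p = trans (isYes≗does P?) (dec-true P? p)

⌊⌋≡true⁻ : ∀ {p} {P : Set p} (P? : Dec P) → ⌊ P? ⌋ ≡ true → P
⌊⌋≡true⁻ (yes p) _ = p

not⌊⌋≡false⁻ : ∀ {p} {P : Set p} (P? : Dec P) → not ⌊ P? ⌋ ≡ false → P
not⌊⌋≡false⁻ (yes p) _ = p

sumFin-cong : ∀ {n} {f g : Fin n → ℕ} → (∀ i → f i ≡ g i) → sumFin f ≡ sumFin g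
sumFin-cong {zero}  f≗g = refl
sumFin-cong {suc n} f≗g = cong₂ _+_ (f≗g zero) (sumFin-cong (λ i → f≗g (suc i)))

sumFin-mono-≤ : ∀ {n} {f g : Fin n → ℕ} → (∀ i → f i ≤ g i) → sumFin f ≤ sumFin g
sumFin-mono-≤ {zero}  f≤g = z≤n
sumFin-mono-≤ {suc n} f≤g = +-mono-≤ (f≤g zero) (sumFin-mono-≤ (λ i → f≤g (suc i)))

sumFin-distrib-+ : ∀ {n} (f g : Fin n → ℕ) →
  sumFin (λ i → f i + g i) ≡ sumFin f + sumFin g
sumFin-distrib-+ {zero}  f g = refl
sumFin-distrib-+ {suc n} f g = trans
  (cong (f zero + g zero +_) (sumFin-distrib-+ (λ i → f (suc i)) (λ i → g (suc i))))
  (interchange (f zero) (g zero) _ _)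
  where
  interchange : ∀ a b c e → a + b + (c + e) ≡ a + c + (b + e)
  interchange = solve-∀

*-distribˡ-sumFin : ∀ {n} c (f : Fin n → ℕ) → c * sumFin f ≡ sumFin (λ i → c * f i)
*-distribˡ-sumFin {zero}  c f = *-zeroʳ c
*-distribˡ-sumFin {suc n} c f = trans (*-distribˡ-+ c (f zero) _)
  (cong (c * f zero +_) (*-distribˡ-sumFin c (λ i → f (suc i))))

*-distribʳ-sumFin : ∀ {n} c (f : Fin n → ℕ) → sumFin f * c ≡ sumFin (λ i → f i * c)
*-distribʳ-sumFin c f = trans (*-comm _ c)
  (trans (*-distribˡ-sumFin c f) (sumFin-cong (λ i → *-comm c (f i))))

sumFin-const : ∀ n c → sumFin {n} (λ _ → c) ≡ n * c
sumFin-const zero    c = refl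
sumFin-const (suc n) c = cong (c +_) (sumFin-const n c)

sumFin-zero : ∀ n → sumFin {n} (λ _ → 0) ≡ 0
sumFin-zero n = trans (sumFin-const n 0) (*-zeroʳ n)

sumFin-≤-bound : ∀ {n} c {f : Fin n → ℕ} → (∀ i → f i ≤ c) → sumFin f ≤ n * c
sumFin-≤-bound {n} c f≤c = ≤-trans (sumFin-mono-≤ f≤c) (≤-reflexive (sumFin-const n c))

≤-sumFin : ∀ {n} (f : Fin n → ℕ) i → f i ≤ sumFin f
≤-sumFin f zero    = m≤m+n _ _
≤-sumFin f (suc i) = ≤-trans (≤-sumFin (λ j → f (suc j)) i) (m≤n+m _ (f zero))

sumFin≡0⇒≡0 : ∀ {n} (f : Fin n → ℕ) → sumFin f ≡ 0 → ∀ i → f i ≡ 0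
sumFin≡0⇒≡0 f eq i = n≤0⇒n≡0 (≤-trans (≤-sumFin f i) (≤-reflexive eq))

sumFin-comm : ∀ {n m} (f : Fin n → Fin m → ℕ) →
  sumFin (λ i → sumFin (λ j → f i j)) ≡ sumFin (λ j → sumFin (λ i → f i j))
sumFin-comm {zero}  {m} f = sym (sumFin-zero m)
sumFin-comm {suc n} {m} f = trans
  (cong (sumFin (f zero) +_) (sumFin-comm (λ i → f (suc i))))
  (sym (sumFin-distrib-+ (f zero) (λ j → sumFin (λ i → f (suc i) j))))

sumFin-product : ∀ {n m} (f : Fin n → ℕ) (g : Fin m → ℕ) →
  sumFin (λ i → sumFin (λ j → f i * g j)) ≡ sumFin f * sumFin g
sumFin-product f g = trans (sumFin-cong (λ i → sym (*-distribˡ-sumFin (f i) g)))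
  (sym (*-distribʳ-sumFin (sumFin g) f))

δ : ∀ {n} → Fin n → Fin n → ℕ
δ a i = 𝟙 ⌊ a Fin.≟ i ⌋

sumFin-δ : ∀ {n} (a : Fin n) (g : Fin n → ℕ) → sumFin (λ i → δ a i * g i) ≡ g a
sumFin-δ {suc n} zero g = trans (cong (g zero + 0 +_) (sumFin-zero n))
  (trans (+-identityʳ _) (+-identityʳ (g zero)))
sumFin-δ {suc n} (suc a) g = trans
  (sumFin-cong (λ i → cong (λ b → 𝟙 b * g (suc i)) (suc-≟-suc i)))
  (sumFin-δ a (λ i → g (suc i)))
  where
  suc-≟-suc : ∀ i → ⌊ suc a Fin.≟ suc i ⌋ ≡ ⌊ a Fin.≟ i ⌋
  suc-≟-suc i with a Fin.≟ i
  ... | yes _ = refl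
  ... | no _  = refl

sumFin-δ-1 : ∀ {n} (a : Fin n) → sumFin (δ a) ≡ 1
sumFin-δ-1 a = trans (sumFin-cong (λ i → sym (*-identityʳ (δ a i)))) (sumFin-δ a (λ _ → 1))

∣∣≡sumFin : ∀ {n} (p : Subset n) → ∣ p ∣ ≡ sumFin (λ x → 𝟙 (lookup p x))
∣∣≡sumFin []          = refl
∣∣≡sumFin (true ∷ p)  = cong suc (∣∣≡sumFin p)
∣∣≡sumFin (false ∷ p) = ∣∣≡sumFin p

∃-≤-average : ∀ {n} (f : Fin n → ℕ) → 0 < n → ∃[ i ] f i * n ≤ sumFin f
∃-≤-average {suc zero} f _ = zero , ≤-reflexive (trans (*-identityʳ _) (sym (+-identityʳ _)))
∃-≤-average {suc (suc n)} f _ with ∃-≤-average (λ i → f (suc i)) (s≤s z≤n)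
... | i , fᵢ≤avg with f zero ≤? f (suc i)
...   | yes f₀≤fᵢ = zero , ≤-trans (≤-reflexive (*-suc (f zero) (suc n)))
                        (+-monoʳ-≤ (f zero) (≤-trans (*-monoˡ-≤ (suc n) f₀≤fᵢ) fᵢ≤avg))
...   | no f₀≰fᵢ = suc i , ≤-trans (≤-reflexive (*-suc (f (suc i)) (suc n)))
                        (+-mono-≤ (≰⇒≥ f₀≰fᵢ) fᵢ≤avg)

sumFin-𝟙-unique : ∀ {n p} {P : Pred (Fin n) p} (P? : Decidable P) →
  (∀ k l → P k → P l → k ≡ l) → sumFin (λ k → 𝟙 ⌊ P? k ⌋) ≤ 1
sumFin-𝟙-unique {zero}  P? unique = z≤n
sumFin-𝟙-unique {suc n} P? unique with P? zero
... | yes P₀ = s≤s (≤-reflexive (trans (sumFin-cong others-absent) (sumFin-zero n)))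
  where
  others-absent : ∀ i → 𝟙 ⌊ P? (suc i) ⌋ ≡ 0
  others-absent i with P? (suc i)
  ... | yes Pᵢ with () ← unique zero (suc i) P₀ Pᵢ
  ... | no _ = refl
... | no _ = sumFin-𝟙-unique (λ i → P? (suc i))
  (λ k l Pk Pl → Finₚ.suc-injective (unique (suc k) (suc l) Pk Pl))

sumFin-𝟙-≤-any : ∀ {n p} {P : Pred (Fin n) p} (P? : Decidable P) →
  (∀ k l → P k → P l → k ≡ l) → sumFin (λ k → 𝟙 ⌊ P? k ⌋) ≤ 𝟙 ⌊ any? P? ⌋
sumFin-𝟙-≤-any {n} P? unique with any? P?
... | yes _ = sumFin-𝟙-unique P? unique
... | no ∄P = ≤-reflexive (trans (sumFin-cong absent) (sumFin-zero n))
  where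
  absent : ∀ k → 𝟙 ⌊ P? k ⌋ ≡ 0
  absent k with P? k
  ... | yes Pk = ⊥-elim (∄P (k , Pk))
  ... | no _ = refl

𝟙-any≤sumFin : ∀ {n p} {P : Pred (Fin n) p} (P? : Decidable P) →
  𝟙 ⌊ any? P? ⌋ ≤ sumFin (λ k → 𝟙 ⌊ P? k ⌋)
𝟙-any≤sumFin P? with any? P?
... | no _ = z≤n
... | yes (k , Pk) = ≤-trans (witnessed (P? k)) (≤-sumFin (λ k → 𝟙 ⌊ P? k ⌋) k)
  where
  witnessed : (d : Dec _) → 1 ≤ 𝟙 ⌊ d ⌋
  witnessed (yes _)  = ≤-refl
  witnessed (no ¬Pk) = ⊥-elim (¬Pk Pk)

^-distribʳ-* : ∀ a b s → (a * b) ^ s ≡ a ^ s * b ^ s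
^-distribʳ-* a b zero    = refl
^-distribʳ-* a b (suc s) = trans (cong (a * b *_) (^-distribʳ-* a b s)) (interchange a b (a ^ s) (b ^ s))
  where
  interchange : ∀ a b c e → a * b * (c * e) ≡ a * c * (b * e)
  interchange = solve-∀

-- The Sauer–Shelah lemma

sumSubsets : ∀ m → (Subset m → ℕ) → ℕ
sumSubsets zero    g = g []
sumSubsets (suc m) g = sumSubsets m (λ v → g (false ∷ v)) + sumSubsets m (λ v → g (true ∷ v))

sumSubsets-cong : ∀ m {f g : Subset m → ℕ} → (∀ v → f v ≡ g v) → sumSubsets m f ≡ sumSubsets m g
sumSubsets-cong zero    f≗g = f≗g []
sumSubsets-cong (suc m) f≗g =
  cong₂ _+_ (sumSubsets-cong m (λ v → f≗g (false ∷ v))) (sumSubsets-cong m (λ v → f≗g (true ∷ v)))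

sumSubsets-mono-≤ : ∀ m {f g : Subset m → ℕ} → (∀ v → f v ≤ g v) → sumSubsets m f ≤ sumSubsets m g
sumSubsets-mono-≤ zero    f≤g = f≤g []
sumSubsets-mono-≤ (suc m) f≤g =
  +-mono-≤ (sumSubsets-mono-≤ m (λ v → f≤g (false ∷ v))) (sumSubsets-mono-≤ m (λ v → f≤g (true ∷ v)))

sumSubsets-distrib-+ : ∀ m (f g : Subset m → ℕ) →
  sumSubsets m (λ v → f v + g v) ≡ sumSubsets m f + sumSubsets m g
sumSubsets-distrib-+ zero    f g = refl
sumSubsets-distrib-+ (suc m) f g = trans
  (cong₂ _+_ (sumSubsets-distrib-+ m (λ v → f (false ∷ v)) (λ v → g (false ∷ v)))
             (sumSubsets-distrib-+ m (λ v → f (true ∷ v)) (λ v → g (true ∷ v))))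
  (interchange (sumSubsets m (λ v → f (false ∷ v))) (sumSubsets m (λ v → g (false ∷ v))) _ _)
  where
  interchange : ∀ a b c e → a + b + (c + e) ≡ a + c + (b + e)
  interchange = solve-∀

sumSubsets-zero : ∀ m → sumSubsets m (λ _ → 0) ≡ 0
sumSubsets-zero zero    = refl
sumSubsets-zero (suc m) = cong₂ _+_ (sumSubsets-zero m) (sumSubsets-zero m)

sumSubsets-supported : ∀ m (w : Subset m) (f : Subset m → ℕ) →
  (∀ v → v ≢ w → f v ≡ 0) → sumSubsets m f ≡ f w
sumSubsets-supported zero    []          f f≡0 = refl
sumSubsets-supported (suc m) (false ∷ w) f f≡0 = trans
  (cong₂ _+_ (sumSubsets-supported m w (λ v → f (false ∷ v)) (λ v v≢w → f≡0 _ (v≢w ∘ ∷-injectiveʳ)))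
             (trans (sumSubsets-cong m (λ v → f≡0 (true ∷ v) (λ ()))) (sumSubsets-zero m)))
  (+-identityʳ _)
sumSubsets-supported (suc m) (true ∷ w) f f≡0 =
  cong₂ _+_ (trans (sumSubsets-cong m (λ v → f≡0 (false ∷ v) (λ ()))) (sumSubsets-zero m))
            (sumSubsets-supported m w (λ v → f (true ∷ v)) (λ v v≢w → f≡0 _ (v≢w ∘ ∷-injectiveʳ)))

sumSubsets-sumFin-comm : ∀ m {n} (f : Subset m → Fin n → ℕ) →
  sumSubsets m (λ v → sumFin (f v)) ≡ sumFin (λ i → sumSubsets m (λ v → f v i))
sumSubsets-sumFin-comm zero    f = refl
sumSubsets-sumFin-comm (suc m) f = trans
  (cong₂ _+_ (sumSubsets-sumFin-comm m (λ v → f (false ∷ v)))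
             (sumSubsets-sumFin-comm m (λ v → f (true ∷ v))))
  (sym (sumFin-distrib-+ (λ i → sumSubsets m (λ v → f (false ∷ v) i)) _))

FamilyShatters : ∀ {m} → (Subset m → Bool) → Subset m → Set
FamilyShatters {m} P J = ∀ (K : Subset m) → K ⊆ J →
  ∃[ v ] (P v ≡ true × (∀ y → (lookup v y ∧ lookup J y) ≡ lookup K y))

nonempty⇒shatters-⊥ : ∀ {m} (P : Subset m → Bool) v → P v ≡ true → FamilyShatters P ⊥
nonempty⇒shatters-⊥ P v Pv K K⊆⊥ = v , Pv , λ y → begin
  lookup v y ∧ lookup ⊥ y ≡⟨ cong (lookup v y ∧_) (lookup-replicate y false) ⟩
  lookup v y ∧ false      ≡⟨ ∧-zeroʳ (lookup v y) ⟩
  false                   ≡⟨ K-empty y ⟨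
  lookup K y              ∎
  where
  open ≡-Reasoning
  K-empty : ∀ y → lookup K y ≡ false
  K-empty y with lookup K y in Ky
  ... | false = refl
  ... | true  = ⊥-elim (∉⊥ (K⊆⊥ (lookup⇒[]= y K Ky)))

∧≡true⇒ : ∀ {a b} → (a ∧ b) ≡ true → a ≡ true × b ≡ true
∧≡true⇒ {true} {true} _ = refl , refl

𝟙-∨+𝟙-∧ : ∀ a b → 𝟙 a + 𝟙 b ≡ 𝟙 (a ∨ b) + 𝟙 (a ∧ b)
𝟙-∨+𝟙-∧ true  true  = refl
𝟙-∨+𝟙-∧ true  false = refl
𝟙-∨+𝟙-∧ false true  = refl
𝟙-∨+𝟙-∧ false false = refl

-- The weaker bound (|I|+1)^k in place of ∑_{i<k} C(|I|,i) satisfies the same recursion.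
sauer-shelah : ∀ m (I : Subset m) k (P : Subset m → Bool) →
  (∀ v → P v ≡ true → v ⊆ I) →
  (∀ J → FamilyShatters P J → ∣ J ∣ < k) →
  sumSubsets m (λ v → 𝟙 (P v)) ≤ suc ∣ I ∣ ^ k
sauer-shelah m I zero P P⊆I vc = ≤-trans (≤-reflexive
  (trans (sumSubsets-cong m P-empty) (sumSubsets-zero m))) z≤n
  where
  P-empty : ∀ v → 𝟙 (P v) ≡ 0
  P-empty v with P v in Pv
  ... | false = refl
  ... | true with () ← vc ⊥ (nonempty⇒shatters-⊥ P v Pv)
sauer-shelah zero [] (suc k) P P⊆I vc = ≤-trans (𝟙≤1 (P [])) (≤-reflexive (sym (^-zeroˡ (suc k))))
sauer-shelah (suc m) (false ∷ I) (suc k) P P⊆I vc = begin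
  sumSubsets m (λ v → 𝟙 (P (false ∷ v))) + sumSubsets m (λ v → 𝟙 (P (true ∷ v)))
    ≡⟨ cong (sumSubsets m (λ v → 𝟙 (P (false ∷ v))) +_)
         (trans (sumSubsets-cong m P₁-empty) (sumSubsets-zero m)) ⟩
  sumSubsets m (λ v → 𝟙 (P (false ∷ v))) + 0
    ≡⟨ +-identityʳ _ ⟩
  sumSubsets m (λ v → 𝟙 (P₀ v))
    ≤⟨ sauer-shelah m I (suc k) P₀ (λ v P₀v → drop-∷-⊆ (P⊆I _ P₀v)) vc₀ ⟩
  suc ∣ I ∣ ^ suc k ∎
  where
  open ≤-Reasoning
  P₀ : Subset m → Bool
  P₀ v = P (false ∷ v)
  P₁-empty : ∀ v → 𝟙 (P (true ∷ v)) ≡ 0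
  P₁-empty v with P (true ∷ v) in P₁v
  ... | false = refl
  ... | true with () ← P⊆I (true ∷ v) P₁v here
  vc₀ : ∀ J → FamilyShatters P₀ J → ∣ J ∣ < suc k
  vc₀ J sh = vc (false ∷ J) sh′
    where
    sh′ : FamilyShatters P (false ∷ J)
    sh′ (true ∷ K) K⊆ with () ← K⊆ here
    sh′ (false ∷ K) K⊆ with sh K (drop-∷-⊆ K⊆)
    ... | v , P₀v , trace = false ∷ v , P₀v , λ { zero → refl ; (suc y) → trace y }
sauer-shelah (suc m) (true ∷ I) (suc k) P P⊆I vc = begin
  sumSubsets m (λ v → 𝟙 (P (false ∷ v))) + sumSubsets m (λ v → 𝟙 (P (true ∷ v)))
    ≡⟨ sumSubsets-distrib-+ m _ _ ⟨
  sumSubsets m (λ v → 𝟙 (P (false ∷ v)) + 𝟙 (P (true ∷ v)))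
    ≡⟨ sumSubsets-cong m (λ v → 𝟙-∨+𝟙-∧ (P (false ∷ v)) (P (true ∷ v))) ⟩
  sumSubsets m (λ v → 𝟙 (P∨ v) + 𝟙 (P∧ v))
    ≡⟨ sumSubsets-distrib-+ m _ _ ⟩
  sumSubsets m (λ v → 𝟙 (P∨ v)) + sumSubsets m (λ v → 𝟙 (P∧ v))
    ≤⟨ +-mono-≤ (sauer-shelah m I (suc k) P∨ P∨⊆I vc∨) (sauer-shelah m I k P∧ P∧⊆I vc∧) ⟩
  suc ∣ I ∣ ^ suc k + suc ∣ I ∣ ^ k
    ≤⟨ +-mono-≤ (*-monoʳ-≤ (suc ∣ I ∣) (^-monoˡ-≤ k (n≤1+n _))) (^-monoˡ-≤ k (n≤1+n _)) ⟩
  suc ∣ I ∣ * suc (suc ∣ I ∣) ^ k + suc (suc ∣ I ∣) ^ k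
    ≡⟨ +-comm (suc ∣ I ∣ * suc (suc ∣ I ∣) ^ k) _ ⟩
  suc (suc ∣ I ∣) ^ suc k ∎
  where
  open ≤-Reasoning
  P∨ P∧ : Subset m → Bool
  P∨ v = P (false ∷ v) ∨ P (true ∷ v)
  P∧ v = P (false ∷ v) ∧ P (true ∷ v)
  P∨⊆I : ∀ v → P∨ v ≡ true → v ⊆ I
  P∨⊆I v P∨v with P (false ∷ v) in P₀v
  ... | true  = drop-∷-⊆ (P⊆I (false ∷ v) P₀v)
  ... | false = drop-∷-⊆ (P⊆I (true ∷ v) P∨v)
  P∧⊆I : ∀ v → P∧ v ≡ true → v ⊆ I
  P∧⊆I v P∧v = drop-∷-⊆ (P⊆I (false ∷ v) (proj₁ (∧≡true⇒ P∧v)))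
  vc∨ : ∀ J → FamilyShatters P∨ J → ∣ J ∣ < suc k
  vc∨ J sh = vc (false ∷ J) sh′
    where
    sh′ : FamilyShatters P (false ∷ J)
    sh′ (true ∷ K) K⊆ with () ← K⊆ here
    sh′ (false ∷ K) K⊆ with sh K (drop-∷-⊆ K⊆)
    ... | v , P∨v , trace with P (false ∷ v) in P₀v
    ...   | true  = false ∷ v , P₀v , λ { zero → refl ; (suc y) → trace y }
    ...   | false = true ∷ v , P∨v , λ { zero → refl ; (suc y) → trace y }
  -- A set shattered by P∧ extends by the new point to a set shattered by P.
  vc∧ : ∀ J → FamilyShatters P∧ J → ∣ J ∣ < k
  vc∧ J sh = ≤-pred (vc (true ∷ J) sh′)
    where
    sh′ : FamilyShatters P (true ∷ J)
    sh′ (b ∷ K) K⊆ with sh K (drop-∷-⊆ K⊆)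
    ... | v , P∧v , trace = b ∷ v , P-both b , λ { zero → ∧-identityʳ b ; (suc y) → trace y }
      where
      P-both : ∀ b → P (b ∷ v) ≡ true
      P-both false = proj₁ (∧≡true⇒ P∧v)
      P-both true  = proj₂ (∧≡true⇒ P∧v)

_≟ˢ_ : ∀ {m} → DecidableEquality (Subset m)
_≟ˢ_ = ≡-dec Bool._≟_

inImage : ∀ {N m} → (Fin N → Subset m) → Subset m → Bool
inImage T v = ⌊ any? (λ k → T k ≟ˢ v) ⌋

injective⇒≤#image : ∀ m {N} (T : Fin N → Subset m) → (∀ k l → T k ≡ T l → k ≡ l) →
  N ≤ sumSubsets m (λ v → 𝟙 (inImage T v))
injective⇒≤#image m {N} T T-inj = begin
  N                                                    ≡⟨ *-identityʳ N ⟨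
  N * 1                                                ≡⟨ sumFin-const N 1 ⟨
  sumFin {N} (λ k → 1)                                 ≡⟨ sumFin-cong (λ k → single k) ⟨
  sumFin (λ k → sumSubsets m (λ v → 𝟙 ⌊ T k ≟ˢ v ⌋))   ≡⟨ sumSubsets-sumFin-comm m (λ v k → 𝟙 ⌊ T k ≟ˢ v ⌋) ⟨
  sumSubsets m (λ v → sumFin (λ k → 𝟙 ⌊ T k ≟ˢ v ⌋))   ≤⟨ sumSubsets-mono-≤ m (λ v →
                                                            sumFin-𝟙-≤-any (λ k → T k ≟ˢ v)
                                                              (λ k l Tk≡v Tl≡v → T-inj k l (trans Tk≡v (sym Tl≡v)))) ⟩
  sumSubsets m (λ v → 𝟙 (inImage T v))                 ∎
  where
  open ≤-Reasoning
  single : ∀ k → sumSubsets m (λ v → 𝟙 ⌊ T k ≟ˢ v ⌋) ≡ 1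
  single k = trans (sumSubsets-supported m (T k) _ off-diagonal) (cong (𝟙 ∘ ⌊_⌋) (≡-≟-identity _≟ˢ_ refl))
    where
    off-diagonal : ∀ v → v ≢ T k → 𝟙 ⌊ T k ≟ˢ v ⌋ ≡ 0
    off-diagonal v v≢Tk = cong (𝟙 ∘ ⌊_⌋) (≢-≟-identity _≟ˢ_ (v≢Tk ∘ sym))

-- Separated rows are few

prodFin : ∀ {s} → (Fin s → ℕ) → ℕ
prodFin {zero}  h = 1
prodFin {suc s} h = h zero * prodFin (h ∘ suc)

prodFin≡0⇒∃≡0 : ∀ {s} (h : Fin s → ℕ) → prodFin h ≡ 0 → ∃[ i ] h i ≡ 0
prodFin≡0⇒∃≡0 {suc s} h eq with m*n≡0⇒m≡0∨n≡0 (h zero) eq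
... | inj₁ h₀≡0 = zero , h₀≡0
... | inj₂ rest≡0 with prodFin≡0⇒∃≡0 (h ∘ suc) rest≡0
...   | i , hᵢ≡0 = suc i , hᵢ≡0

sumTuples : ∀ s {m} → (Vector (Fin m) s → ℕ) → ℕ
sumTuples zero    g = g Vector.[]
sumTuples (suc s) g = sumFin (λ y → sumTuples s (λ f → g (y Vector.∷ f)))

*-distribˡ-sumTuples : ∀ s {m} c (g : Vector (Fin m) s → ℕ) →
  c * sumTuples s g ≡ sumTuples s (λ f → c * g f)
*-distribˡ-sumTuples zero    c g = refl
*-distribˡ-sumTuples (suc s) c g = trans (*-distribˡ-sumFin c (λ y → sumTuples s (λ f → g (y Vector.∷ f))))
  (sumFin-cong (λ y → *-distribˡ-sumTuples s c (λ f → g (y Vector.∷ f))))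

sumTuples-sumFin-comm : ∀ s {m N} (g : Vector (Fin m) s → Fin N → ℕ) →
  sumTuples s (λ f → sumFin (g f)) ≡ sumFin (λ k → sumTuples s (λ f → g f k))
sumTuples-sumFin-comm zero    g = refl
sumTuples-sumFin-comm (suc s) g = trans
  (sumFin-cong (λ y → sumTuples-sumFin-comm s (λ f → g (y Vector.∷ f))))
  (sumFin-comm (λ y k → sumTuples s (λ f → g (y Vector.∷ f) k)))

sumTuples-prodFin : ∀ s {m} (h : Fin m → ℕ) →
  sumTuples s (λ f → prodFin (h ∘ f)) ≡ sumFin h ^ s
sumTuples-prodFin zero    h = refl
sumTuples-prodFin (suc s) h = begin
  sumFin (λ y → sumTuples s (λ f → h y * prodFin (h ∘ f)))
    ≡⟨ sumFin-cong (λ y → *-distribˡ-sumTuples s (h y) (λ f → prodFin (h ∘ f))) ⟨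
  sumFin (λ y → h y * sumTuples s (λ f → prodFin (h ∘ f)))
    ≡⟨ sumFin-cong (λ y → cong (h y *_) (sumTuples-prodFin s h)) ⟩
  sumFin (λ y → h y * sumFin h ^ s)
    ≡⟨ *-distribʳ-sumFin (sumFin h ^ s) h ⟨
  sumFin h ^ suc s ∎
  where open ≡-Reasoning

∃-≤-average-tuple : ∀ s {m} (g : Vector (Fin m) s → ℕ) → 0 < m →
  ∃[ f ] g f * m ^ s ≤ sumTuples s g
∃-≤-average-tuple zero    g _ = Vector.[] , ≤-reflexive (*-identityʳ _)
∃-≤-average-tuple (suc s) {m} g m>0
  with y , y-below ← ∃-≤-average (λ y → sumTuples s (λ f → g (y Vector.∷ f))) m>0
  with f , f-below ← ∃-≤-average-tuple s (λ f → g (y Vector.∷ f)) m>0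
  = y Vector.∷ f , ≤-trans (≤-reflexive (reassoc (g (y Vector.∷ f)) m (m ^ s)))
                           (≤-trans (*-monoˡ-≤ m f-below) y-below)
  where
  reassoc : ∀ a b c → a * (b * c) ≡ a * c * b
  reassoc = solve-∀

module _ {n m} (F : Rel n m) where

  rowDist rowAgree : Fin n → Fin n → ℕ
  rowDist  x x′ = sumFin (λ y → 𝟙 (F x y xor F x′ y))
  rowAgree x x′ = sumFin (λ y → 𝟙 (not (F x y xor F x′ y)))

  Close : ℕ → Fin n → Fin n → Set
  Close t x x′ = suc t * rowDist x x′ ≤ m

  rowDist≤m : ∀ x x′ → rowDist x x′ ≤ m
  rowDist≤m x x′ = ≤-trans (sumFin-≤-bound 1 (λ y → 𝟙≤1 (F x y xor F x′ y))) (≤-reflexive (*-identityʳ m))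

  Close-refl : ∀ t x → Close t x x
  Close-refl t x = ≤-trans (≤-reflexive (trans (cong (suc t *_) rowDist-self) (*-zeroʳ (suc t)))) z≤n
    where
    rowDist-self : rowDist x x ≡ 0
    rowDist-self = trans (sumFin-cong (λ y → cong 𝟙 (xor-same (F x y)))) (sumFin-zero m)

  Close-sym : ∀ t x x′ → Close t x x′ → Close t x′ x
  Close-sym t x x′ = subst (λ e → suc t * e ≤ m) (sumFin-cong (λ y → cong 𝟙 (xor-comm (F x y) (F x′ y))))

  Close-of-no-columns : m ≡ 0 → ∀ t x x′ → Close t x x′
  Close-of-no-columns m≡0 t x x′ = ≤-trans (*-monoʳ-≤ (suc t) (rowDist≤m x x′))
    (≤-reflexive (trans (cong (suc t *_) m≡0) (trans (*-zeroʳ (suc t)) (sym m≡0))))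

  rowAgree+rowDist : ∀ x x′ → rowAgree x x′ + rowDist x x′ ≡ m
  rowAgree+rowDist x x′ = begin
    rowAgree x x′ + rowDist x x′
      ≡⟨ sumFin-distrib-+ (λ y → 𝟙 (not (F x y xor F x′ y))) _ ⟨
    sumFin (λ y → 𝟙 (not (F x y xor F x′ y)) + 𝟙 (F x y xor F x′ y))
      ≡⟨ sumFin-cong (λ y → 𝟙-not+𝟙 (F x y xor F x′ y)) ⟩
    sumFin {m} (λ _ → 1)
      ≡⟨ trans (sumFin-const m 1) (*-identityʳ m) ⟩
    m ∎
    where
    open ≡-Reasoning
    𝟙-not+𝟙 : ∀ b → 𝟙 (not b) + 𝟙 b ≡ 1
    𝟙-not+𝟙 true  = refl
    𝟙-not+𝟙 false = refl

  ¬Close⇒rowAgree≤ : ∀ t x x′ → ¬ Close t x x′ → suc t * rowAgree x x′ ≤ t * m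
  ¬Close⇒rowAgree≤ t x x′ far = +-cancelʳ-≤ m _ _ (begin
    suc t * rowAgree x x′ + m                       ≤⟨ +-monoʳ-≤ _ (<⇒≤ (≰⇒> far)) ⟩
    suc t * rowAgree x x′ + suc t * rowDist x x′    ≡⟨ *-distribˡ-+ (suc t) (rowAgree x x′) (rowDist x x′) ⟨
    suc t * (rowAgree x x′ + rowDist x x′)          ≡⟨ cong (suc t *_) (rowAgree+rowDist x x′) ⟩
    m + t * m                                       ≡⟨ +-comm m (t * m) ⟩
    t * m + m                                       ∎)
    where open ≤-Reasoning

  Separates : ∀ {N s} → (Fin N → Fin n) → Vector (Fin m) s → Set
  Separates c f = ∀ k l → k ≢ l → ∃[ i ] F (c k) (f i) ≢ F (c l) (f i)

  module _ {N} (t s : ℕ) (c : Fin N → Fin n) (far : ∀ k l → k ≢ l → ¬ Close t (c k) (c l)) where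

    off-diagonal : Fin N → Fin N → ℕ
    off-diagonal k l = 𝟙 (not ⌊ k Fin.≟ l ⌋)

    agreeOn : Fin N → Fin N → Vector (Fin m) s → ℕ
    agreeOn k l f = prodFin (λ i → 𝟙 (not (F (c k) (f i) xor F (c l) (f i))))

    collisions : Vector (Fin m) s → ℕ
    collisions f = sumFin (λ k → sumFin (λ l → off-diagonal k l * agreeOn k l f))

    pairAgreement : Fin N → Fin N → ℕ
    pairAgreement k l = off-diagonal k l * rowAgree (c k) (c l) ^ s

    sumTuples-collisions : sumTuples s collisions ≡ sumFin (λ k → sumFin (pairAgreement k))
    sumTuples-collisions =
      trans (sumTuples-sumFin-comm s (λ f k → sumFin (λ l → off-diagonal k l * agreeOn k l f)))
      (sumFin-cong λ k → trans (sumTuples-sumFin-comm s (λ f l → off-diagonal k l * agreeOn k l f))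
      (sumFin-cong λ l → trans (sym (*-distribˡ-sumTuples s (off-diagonal k l) (agreeOn k l)))
        (cong (off-diagonal k l *_) (sumTuples-prodFin s (λ y → 𝟙 (not (F (c k) y xor F (c l) y)))))))

    pairAgreement-bound : ∀ k l → suc t ^ s * pairAgreement k l ≤ t ^ s * m ^ s
    pairAgreement-bound k l with k Fin.≟ l
    ... | yes _  = ≤-trans (≤-reflexive (*-zeroʳ (suc t ^ s))) z≤n
    ... | no k≢l = begin
      suc t ^ s * (rowAgree (c k) (c l) ^ s + 0)   ≡⟨ cong (suc t ^ s *_) (+-identityʳ _) ⟩
      suc t ^ s * rowAgree (c k) (c l) ^ s         ≡⟨ ^-distribʳ-* (suc t) _ s ⟨
      (suc t * rowAgree (c k) (c l)) ^ s           ≤⟨ ^-monoˡ-≤ s (¬Close⇒rowAgree≤ t (c k) (c l) (far k l k≢l)) ⟩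
      (t * m) ^ s                                  ≡⟨ ^-distribʳ-* t m s ⟩
      t ^ s * m ^ s                                ∎
      where open ≤-Reasoning

    collisions-bound : suc t ^ s * sumTuples s collisions ≤ N * (N * (t ^ s * m ^ s))
    collisions-bound = begin
      suc t ^ s * sumTuples s collisions
        ≡⟨ cong (suc t ^ s *_) sumTuples-collisions ⟩
      suc t ^ s * sumFin (λ k → sumFin (pairAgreement k))
        ≡⟨ *-distribˡ-sumFin (suc t ^ s) (λ k → sumFin (pairAgreement k)) ⟩
      sumFin (λ k → suc t ^ s * sumFin (pairAgreement k))
        ≡⟨ sumFin-cong (λ k → *-distribˡ-sumFin (suc t ^ s) (pairAgreement k)) ⟩
      sumFin (λ k → sumFin (λ l → suc t ^ s * pairAgreement k l))
        ≤⟨ sumFin-≤-bound _ (λ k → sumFin-≤-bound _ (pairAgreement-bound k)) ⟩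
      N * (N * (t ^ s * m ^ s)) ∎
      where open ≤-Reasoning

    collision-free⇒separates : ∀ f → collisions f ≡ 0 → Separates c f
    collision-free⇒separates f no-collision k l k≢l =
      map₂ 𝟙-not-xor≡0⇒≢ (prodFin≡0⇒∃≡0 _ agreeOn≡0)
      where
      agreeOn≡0 : agreeOn k l f ≡ 0
      agreeOn≡0 = begin
        agreeOn k l f                          ≡⟨ *-identityˡ _ ⟨
        1 * agreeOn k l f                      ≡⟨ cong (_* agreeOn k l f) (off-diagonal≡1 (k Fin.≟ l)) ⟨
        off-diagonal k l * agreeOn k l f       ≡⟨ sumFin≡0⇒≡0 _ (sumFin≡0⇒≡0 _ no-collision k) l ⟩
        0                                      ∎
        where
        open ≡-Reasoning
        off-diagonal≡1 : (k≟l : Dec (k ≡ l)) → 𝟙 (not ⌊ k≟l ⌋) ≡ 1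
        off-diagonal≡1 (yes k≡l) = ⊥-elim (k≢l k≡l)
        off-diagonal≡1 (no _)    = refl
      𝟙-not-xor≡0⇒≢ : ∀ {a b} → 𝟙 (not (a xor b)) ≡ 0 → a ≢ b
      𝟙-not-xor≡0⇒≢ {true}  () refl
      𝟙-not-xor≡0⇒≢ {false} () refl

    -- Averaging: on a random s-tuple of columns the expected number of colliding pairs is < 1.
    separating-tuple : 0 < m → N * N * t ^ s < suc t ^ s → ∃[ f ] Separates c f
    separating-tuple m>0 hyp with f , f-below ← ∃-≤-average-tuple s collisions m>0 =
      f , collision-free⇒separates f (n≤0⇒n≡0 (≮⇒≥ no-collision))
      where
      instance
        _ : ℕ.NonZero (m ^ s)
        _ = ℕ.>-nonZero (m^n>0 m {{ℕ.>-nonZero m>0}} s)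
      no-collision : ¬ 0 < collisions f
      no-collision 0<collisions = <-irrefl refl (begin-strict
        suc t ^ s * m ^ s                                ≤⟨ *-monoʳ-≤ (suc t ^ s)
                                                              (m≤n*m (m ^ s) (collisions f) {{ℕ.>-nonZero 0<collisions}}) ⟩
        suc t ^ s * (collisions f * m ^ s)               ≤⟨ *-monoʳ-≤ (suc t ^ s) f-below ⟩
        suc t ^ s * sumTuples s collisions               ≤⟨ collisions-bound ⟩
        N * (N * (t ^ s * m ^ s))                        ≡⟨ reassoc N (t ^ s) (m ^ s) ⟩
        N * N * t ^ s * m ^ s                            <⟨ *-monoˡ-< (m ^ s) hyp ⟩
        suc t ^ s * m ^ s                                ∎)
        where
        open ≤-Reasoning
        reassoc : ∀ a b c → a * (a * (b * c)) ≡ a * a * b * c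
        reassoc = solve-∀

  module _ {N s} (c : Fin N → Fin n) (f : Vector (Fin m) s) (separates : Separates c f) where

    sampled : Subset m
    sampled = tabulate (λ y → ⌊ any? (λ i → f i Fin.≟ y) ⌋)

    ∣sampled∣≤s : ∣ sampled ∣ ≤ s
    ∣sampled∣≤s = begin
      ∣ sampled ∣                                      ≡⟨ ∣∣≡sumFin sampled ⟩
      sumFin (λ y → 𝟙 (lookup sampled y))              ≡⟨ sumFin-cong {m} (λ y → cong 𝟙 (lookup∘tabulate _ y)) ⟩
      sumFin (λ y → 𝟙 ⌊ any? (λ i → f i Fin.≟ y) ⌋)    ≤⟨ sumFin-mono-≤ (λ y → 𝟙-any≤sumFin (λ i → f i Fin.≟ y)) ⟩
      sumFin (λ y → sumFin (λ i → δ (f i) y))          ≡⟨ sumFin-comm (λ y i → δ (f i) y) ⟩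
      sumFin (λ i → sumFin (δ (f i)))                  ≡⟨ sumFin-cong (λ i → sumFin-δ-1 (f i)) ⟩
      sumFin {s} (λ _ → 1)                             ≡⟨ trans (sumFin-const s 1) (*-identityʳ s) ⟩
      s                                                ∎
      where open ≤-Reasoning

    f-sampled : ∀ i → lookup sampled (f i) ≡ true
    f-sampled i = trans (lookup∘tabulate _ (f i)) (⌊⌋≡true (any? (λ j → f j Fin.≟ f i)) (i , refl))

    trace : Fin N → Subset m
    trace k = tabulate (λ y → F (c k) y ∧ lookup sampled y)

    trace-injective : ∀ k l → trace k ≡ trace l → k ≡ l
    trace-injective k l trace-eq with k Fin.≟ l
    ... | yes k≡l = k≡l
    ... | no k≢l with i , differ ← separates k l k≢l = ⊥-elim (differ (begin
      F (c k) (f i)                            ≡⟨ ∧-identityʳ _ ⟨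
      F (c k) (f i) ∧ true                     ≡⟨ cong (F (c k) (f i) ∧_) (f-sampled i) ⟨
      F (c k) (f i) ∧ lookup sampled (f i)     ≡⟨ lookup∘tabulate _ (f i) ⟨
      lookup (trace k) (f i)                   ≡⟨ cong (λ v → lookup v (f i)) trace-eq ⟩
      lookup (trace l) (f i)                   ≡⟨ lookup∘tabulate _ (f i) ⟩
      F (c l) (f i) ∧ lookup sampled (f i)     ≡⟨ cong (F (c l) (f i) ∧_) (f-sampled i) ⟩
      F (c l) (f i) ∧ true                     ≡⟨ ∧-identityʳ _ ⟩
      F (c l) (f i)                            ∎))
      where open ≡-Reasoning

    inImage⇒trace : ∀ v → inImage trace v ≡ true → ∃[ k ] trace k ≡ v
    inImage⇒trace v = ⌊⌋≡true⁻ (any? (λ k → trace k ≟ˢ v))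

    trace⊆sampled : ∀ v → inImage trace v ≡ true → v ⊆ sampled
    trace⊆sampled v v∈image {y} y∈v with k , refl ← inImage⇒trace v v∈image =
      lookup⇒[]= y sampled (proj₂ (∧≡true⇒ (trans (sym (lookup∘tabulate _ y)) ([]=⇒lookup y∈v))))

    -- A set shattered by the traces lies inside the sample, where traces agree with rows.
    traces-shatter⇒rows-shatter : ∀ J → FamilyShatters (inImage trace) J → Shatters F J
    traces-shatter⇒rows-shatter J sh K K⊆J
      with v , v∈image , v∩J≡K ← sh K K⊆J
      with k , refl ← inImage⇒trace v v∈image
      = c k , λ y → trans (row∩J≡trace∩J y) (v∩J≡K y)
      where
      J⊆sampled : ∀ y → lookup J y ≡ true → lookup sampled y ≡ true
      J⊆sampled y y∈J with w , w∈image , w∩J≡J ← sh J (λ y∈J → y∈J) =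
        []=⇒lookup (trace⊆sampled w w∈image (lookup⇒[]= y w
          (proj₁ (∧≡true⇒ (trans (w∩J≡J y) y∈J)))))
      row∩J≡trace∩J : ∀ y → (F (c k) y ∧ lookup J y) ≡ (lookup (trace k) y ∧ lookup J y)
      row∩J≡trace∩J y rewrite lookup∘tabulate (λ y → F (c k) y ∧ lookup sampled y) y
        with lookup J y in y∈J
      ... | false = trans (∧-zeroʳ _) (sym (∧-zeroʳ _))
      ... | true rewrite J⊆sampled y y∈J = cong (_∧ true) (sym (∧-identityʳ _))

    separated-rows-bound : ∀ d → FamilyVCDim≤ F d → N ≤ suc s ^ suc d
    separated-rows-bound d vc = begin
      N                                               ≤⟨ injective⇒≤#image m trace trace-injective ⟩
      sumSubsets m (λ v → 𝟙 (inImage trace v))        ≤⟨ sauer-shelah m sampled (suc d) (inImage trace) trace⊆sampled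
                                                           (λ J sh → s≤s (vc J (traces-shatter⇒rows-shatter J sh))) ⟩
      suc ∣ sampled ∣ ^ suc d                         ≤⟨ ^-monoˡ-≤ (suc d) (s≤s ∣sampled∣≤s) ⟩
      suc s ^ suc d                                   ∎
      where open ≤-Reasoning

  packing : ∀ {N} d t s (c : Fin N → Fin n) → FamilyVCDim≤ F d →
    suc (suc s ^ suc d) * suc (suc s ^ suc d) * t ^ s < suc t ^ s →
    (∀ k l → k ≢ l → ¬ Close t (c k) (c l)) →
    N ≤ suc s ^ suc d
  packing {N} d t s c vc hyp far with m ℕ.≟ 0
  ... | yes m≡0 = ≤-trans (at-most-one N c far) (m^n>0 (suc s) (suc d))
    where
    at-most-one : ∀ N (c : Fin N → Fin n) → (∀ k l → k ≢ l → ¬ Close t (c k) (c l)) → N ≤ 1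
    at-most-one zero          c far = z≤n
    at-most-one (suc zero)    c far = ≤-refl
    at-most-one (suc (suc _)) c far = ⊥-elim (far zero (suc zero) (λ ()) (Close-of-no-columns m≡0 t _ _))
  ... | no m≢0 with N ≤? suc s ^ suc d
  ...   | yes N≤B = N≤B
  ...   | no N≰B = ⊥-elim (<-irrefl refl
    (separated-rows-bound c′ (proj₁ separating) (proj₂ separating) d vc))
    where
    c′ : Fin (suc (suc s ^ suc d)) → Fin n
    c′ k = c (Fin.inject≤ k (≰⇒> N≰B))
    far′ : ∀ k l → k ≢ l → ¬ Close t (c′ k) (c′ l)
    far′ k l k≢l = far _ _ (k≢l ∘ Finₚ.inject≤-injective _ _ k l)
    separating : ∃[ f ] Separates c′ f
    separating = separating-tuple t s c′ far′ (n≢0⇒n>0 m≢0) hyp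

-- Greedy nets

module GreedyNet {n ℓ} {_≈_ : Fin n → Fin n → Set ℓ}
  (_≈?_ : B.Decidable _≈_) (≈-refl : B.Reflexive _≈_) (≈-sym : B.Symmetric _≈_) where

  record Net : Set ℓ where
    field
      #centres  : ℕ
      centres   : Fin #centres → Fin n
      separated : ∀ k l → k ≢ l → ¬ centres k ≈ centres l

  open Net

  Covers : Net → Fin n → Set ℓ
  Covers net x = ∃[ k ] x ≈ centres net k

  empty : Net
  empty = record { #centres = 0 ; centres = λ () ; separated = λ () }

  insert : (net : Net) (y : Fin n) →
    Σ Net λ net′ → Covers net′ y × (∀ x → Covers net x → Covers net′ x)
  insert net y with any? (λ k → y ≈? centres net k)
  ... | yes covered  = net , covered , λ _ covers → covers
  ... | no uncovered = net′ , (zero , ≈-refl) , λ { x (k , x≈k) → suc k , x≈k }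
    where
    separated′ : ∀ k l → k ≢ l → ¬ (y Vector.∷ centres net) k ≈ (y Vector.∷ centres net) l
    separated′ zero    zero    0≢0 _   = 0≢0 refl
    separated′ zero    (suc l) _   y≈l = uncovered (l , y≈l)
    separated′ (suc k) zero    _   k≈y = uncovered (k , ≈-sym k≈y)
    separated′ (suc k) (suc l) k≢l     = separated net k l (k≢l ∘ cong suc)
    net′ : Net
    net′ = record { #centres = suc (#centres net) ; centres = y Vector.∷ centres net ; separated = separated′ }

  build : (ys : List (Fin n)) → Σ Net λ net → ∀ x → x ∈ ys → Covers net x
  build []       = empty , λ _ ()
  build (y ∷ ys) with net , covers ← build ys with net′ , covers-y , grows ← insert net y =
    net′ , λ { x (here refl) → covers-y ; x (there x∈ys) → grows x (covers x x∈ys) }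

  net : Net
  net = proj₁ (build (allFin n))

  covering : ∀ x → Covers net x
  covering x = proj₂ (build (allFin n)) x (∈-allFin x)

  netPartition : Partition n
  netPartition = record
    { parts    = #centres net
    ; assign   = λ x → proj₁ (covering x)
    ; nonempty = λ k → centres net k , assign-centre k
    }
    where
    assign-centre : ∀ k → proj₁ (covering (centres net k)) ≡ k
    assign-centre k with j , k≈j ← covering (centres net k) with j Fin.≟ k
    ... | yes j≡k = j≡k
    ... | no j≢k  = ⊥-elim (separated net j k j≢k (≈-sym k≈j))

  centre : Fin (parts netPartition) → Fin n
  centre = centres net

  centre-close : ∀ x → x ≈ centre (assign netPartition x)
  centre-close x = proj₂ (covering x)

  centres-separated : ∀ k l → k ≢ l → ¬ centre k ≈ centre l
  centres-separated = separated net

module Clusters {n m} (F : Rel n m) (t : ℕ) where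

  private
    module Net = GreedyNet (λ x x′ → suc t * rowDist F x x′ ≤? m)
                           (λ {x} → Close-refl F t x) (λ {x} {x′} → Close-sym F t x x′)

  open Net public using (netPartition; centre; centre-close)

  #clusters≤ : ∀ d s → FamilyVCDim≤ F d →
    suc (suc s ^ suc d) * suc (suc s ^ suc d) * t ^ s < suc t ^ s →
    parts netPartition ≤ suc s ^ suc d
  #clusters≤ d s vc hyp = packing F d t s centre vc hyp Net.centres-separated

private
  frac≃ : ∀ a b → toℚᵘ (frac a (suc b)) ℚᵘ.≃ mkℚᵘ (ℤ.+ a) b
  frac≃ a b = ℚ.toℚᵘ-fromℚᵘ (mkℚᵘ (ℤ.+ a) b)

frac-≤ : ∀ a b c e → a * suc e ≤ c * suc b → frac a (suc b) ℚ.≤ frac c (suc e)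
frac-≤ a b c e le = ℚ.toℚᵘ-cancel-≤
  (ℚᵘ.≤-respˡ-≃ (ℚᵘ.≃-sym (frac≃ a b)) (ℚᵘ.≤-respʳ-≃ (ℚᵘ.≃-sym (frac≃ c e))
  (*≤* (subst₂ ℤ._≤_ (ℤ.pos-* a (suc e)) (ℤ.pos-* c (suc b)) (ℤ.+≤+ le)))))

frac-≤⁻ : ∀ a b c e → frac a (suc b) ℚ.≤ frac c (suc e) → a * suc e ≤ c * suc b
frac-≤⁻ a b c e le with ℚᵘ.≤-respˡ-≃ (frac≃ a b) (ℚᵘ.≤-respʳ-≃ (frac≃ c e) (ℚ.toℚᵘ-mono-≤ le))
... | *≤* cross = ℤ.drop‿+≤+ (subst₂ ℤ._≤_ (sym (ℤ.pos-* a (suc e))) (sym (ℤ.pos-* c (suc b))) cross)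

frac-< : ∀ a b c e → a * suc e < c * suc b → frac a (suc b) ℚ.< frac c (suc e)
frac-< a b c e lt = ℚ.toℚᵘ-cancel-<
  (ℚᵘ.<-respˡ-≃ (ℚᵘ.≃-sym (frac≃ a b)) (ℚᵘ.<-respʳ-≃ (ℚᵘ.≃-sym (frac≃ c e))
  (*<* (subst₂ ℤ._<_ (ℤ.pos-* a (suc e)) (ℤ.pos-* c (suc b)) (ℤ.+<+ lt)))))

frac-cong : ∀ a b c e → a * suc e ≡ c * suc b → frac a (suc b) ≡ frac c (suc e)
frac-cong a b c e eq = ℚ.toℚᵘ-injective (ℚᵘ.≃-trans (frac≃ a b) (ℚᵘ.≃-trans
  (*≡* (trans (sym (ℤ.pos-* a (suc e))) (trans (cong ℤ.+_ eq) (ℤ.pos-* c (suc b)))))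
  (ℚᵘ.≃-sym (frac≃ c e))))

frac-+ : ∀ a b c e → frac a (suc b) ℚ.+ frac c (suc e) ≡ frac (a * suc e + c * suc b) (suc b * suc e)
frac-+ a b c e = ℚ.toℚᵘ-injective (ℚᵘ.≃-trans (ℚ.toℚᵘ-homo-+ (frac a (suc b)) (frac c (suc e)))
  (ℚᵘ.≃-trans (ℚᵘ.+-cong (frac≃ a b) (frac≃ c e))
  (ℚᵘ.≃-trans (ℚᵘ.≃-reflexive numerators) (ℚᵘ.≃-sym (frac≃ _ _)))))
  where
  numerators : mkℚᵘ (ℤ.+ a) b ℚᵘ.+ mkℚᵘ (ℤ.+ c) e ≡
               mkℚᵘ (ℤ.+ (a * suc e + c * suc b)) (ℕ.pred (suc b * suc e))
  numerators = cong (λ z → mkℚᵘ z (ℕ.pred (suc b * suc e)))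
    (trans (cong₂ ℤ._+_ (sym (ℤ.pos-* a (suc e))) (sym (ℤ.pos-* c (suc b)))) (sym (ℤ.pos-+ (a * suc e) (c * suc b))))

frac-* : ∀ a b c e → frac a (suc b) ℚ.* frac c (suc e) ≡ frac (a * c) (suc b * suc e)
frac-* a b c e = ℚ.toℚᵘ-injective (ℚᵘ.≃-trans (ℚ.toℚᵘ-homo-* (frac a (suc b)) (frac c (suc e)))
  (ℚᵘ.≃-trans (ℚᵘ.*-cong (frac≃ a b) (frac≃ c e))
  (ℚᵘ.≃-trans (ℚᵘ.≃-reflexive (cong (λ z → mkℚᵘ z (ℕ.pred (suc b * suc e))) (sym (ℤ.pos-* a c))))
  (ℚᵘ.≃-sym (frac≃ _ _)))))

frac-0 : ∀ D → frac 0 D ≡ 0ℚ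
frac-0 zero    = refl
frac-0 (suc D) = frac-cong 0 D 0 0 refl

frac-+-same : ∀ a c D → frac a (suc D) ℚ.+ frac c (suc D) ≡ frac (a + c) (suc D)
frac-+-same a c D = trans (frac-+ a D c D) (frac-cong (a * suc D + c * suc D) (D + D * suc D) (a + c) D (cross a c (suc D)))
  where
  cross : ∀ a c s → (a * s + c * s) * s ≡ (a + c) * (s * s)
  cross = solve-∀

sumFinℚ-frac : ∀ {k} D (f : Fin k → ℕ) → sumFinℚ (λ i → frac (f i) D) ≡ frac (sumFin f) D
sumFinℚ-frac {zero}  D       f = sym (frac-0 D)
sumFinℚ-frac {suc k} zero    f = trans (cong (0ℚ ℚ.+_) (sumFinℚ-frac zero (λ i → f (suc i)))) (ℚ.+-identityˡ 0ℚ)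
sumFinℚ-frac {suc k} (suc D) f = trans (cong (frac (f zero) (suc D) ℚ.+_) (sumFinℚ-frac (suc D) (λ i → f (suc i))))
  (frac-+-same (f zero) _ D)

sumFinℚ-cong : ∀ {k} {f g : Fin k → ℚ} → (∀ i → f i ≡ g i) → sumFinℚ f ≡ sumFinℚ g
sumFinℚ-cong {zero}  f≗g = refl
sumFinℚ-cong {suc k} f≗g = cong₂ ℚ._+_ (f≗g zero) (sumFinℚ-cong (λ i → f≗g (suc i)))

private
  <-+⇒-< : ∀ x y ε → x ℚ.< ε ℚ.+ y → x ℚ.- y ℚ.< ε
  <-+⇒-< x y ε lt = subst (x ℚ.- y ℚ.<_) (solve 2 (λ ε y → ε :+ y :- y := ε) refl ε y) (ℚ.+-monoˡ-< (ℚ.- y) lt)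
    where open ℚ-Solver.+-*-Solver

  neg-sub : ∀ x y → ℚ.- (x ℚ.- y) ≡ y ℚ.- x
  neg-sub = solve 2 (λ x y → :- (x :- y) := y :- x) refl
    where open ℚ-Solver.+-*-Solver

∣-∣<-from-both-sides : ∀ x y ε → x ℚ.< ε ℚ.+ y → y ℚ.< ε ℚ.+ x → ℚ.∣ x ℚ.- y ∣ ℚ.< ε
∣-∣<-from-both-sides x y ε x<ε+y y<ε+x with ℚ.∣p∣≡p∨∣p∣≡-p (x ℚ.- y)
... | inj₁ ∣x-y∣≡x-y = subst (ℚ._< ε) (sym ∣x-y∣≡x-y) (<-+⇒-< x y ε x<ε+y)
... | inj₂ ∣x-y∣≡y-x = subst (ℚ._< ε) (sym (trans ∣x-y∣≡y-x (neg-sub x y))) (<-+⇒-< y x ε y<ε+x)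

frac<ε+frac : ∀ r w w′ e e′ →
  suc r * (e * suc w′) < suc r * (e′ * suc w) + suc w * suc w′ →
  frac e (suc w) ℚ.< frac 1 (suc r) ℚ.+ frac e′ (suc w′)
frac<ε+frac r w w′ e e′ lt = subst (frac e (suc w) ℚ.<_) (sym (frac-+ 1 r e′ w′))
  (frac-< e w (1 * suc w′ + e′ * suc r) (w′ + r * suc w′)
    (subst₂ _<_ (lhs (suc r) e (suc w′)) (rhs (suc r) e′ (suc w) (suc w′)) lt))
  where
  lhs : ∀ r e w′ → r * (e * w′) ≡ e * (r * w′)
  lhs = solve-∀
  rhs : ∀ r e′ w w′ → r * (e′ * w) + w * w′ ≡ (1 * w′ + e′ * r) * w
  rhs = solve-∀

∣frac-frac∣<ε : ∀ r e w e′ w′ → 0 < w → 0 < w′ →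
  suc r * (e * w′) < suc r * (e′ * w) + w * w′ →
  suc r * (e′ * w) < suc r * (e * w′) + w′ * w →
  ℚ.∣ frac e w ℚ.- frac e′ w′ ∣ ℚ.< frac 1 (suc r)
∣frac-frac∣<ε r e (suc w) e′ (suc w′) _ _ lt lt′ = ∣-∣<-from-both-sides _ _ _
  (frac<ε+frac r w w′ e e′ lt) (frac<ε+frac r w′ w e′ e lt′)

ε-fraction⇒≤ : ∀ r k a a′ → 0 < k → frac 1 (suc r) ℚ.* frac a k ℚ.≤ frac a′ k → a ≤ suc r * a′
ε-fraction⇒≤ r (suc k) a a′ _ le = *-cancelʳ-≤ a (suc r * a′) (suc k)
  (subst₂ _≤_ (lhs a (suc k)) (rhs a′ (suc r) (suc k))
    (frac-≤⁻ (1 * a) (k + r * suc k) a′ k (subst (ℚ._≤ frac a′ (suc k)) (frac-* 1 r a k) le)))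
  where
  lhs : ∀ a k → 1 * a * k ≡ a * k
  lhs = solve-∀
  rhs : ∀ a′ r k → a′ * (r * k) ≡ r * a′ * k
  rhs = solve-∀

frac*frac-masked : ∀ N M a c b →
  (if b then frac a N ℚ.* frac c M else 0ℚ) ≡ frac (𝟙 b * (a * c)) (N * M)
frac*frac-masked N       M       a c false = sym (trans (cong (λ z → frac z (N * M)) (*-zeroˡ (a * c))) (frac-0 (N * M)))
frac*frac-masked zero    M       a c true  = ℚ.*-zeroˡ (frac c M)
frac*frac-masked (suc N) zero    a c true  = trans (ℚ.*-zeroʳ (frac a (suc N)))
  (sym (trans (cong (frac _) (*-zeroʳ (suc N))) (frac-0 0)))
frac*frac-masked (suc N) (suc M) a c true  = trans (frac-* a N c M)
  (cong (λ z → frac z (suc N * suc M)) (sym (+-identityʳ (a * c))))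

frac<1/r : ∀ r N W → (0 < N → W * suc r < N) → frac W N ℚ.< frac 1 (suc r)
frac<1/r r zero    W _   = frac-< 0 0 1 r (s≤s z≤n)
frac<1/r r (suc N) W small = frac-< W N 1 r (≤-trans (small (s≤s z≤n)) (≤-reflexive (sym (+-identityʳ _))))

-- Nearly constant blocks are regular

𝟙-∧-mono : ∀ {a b a′ b′} → (a′ ≡ true → a ≡ true) → (b′ ≡ true → b ≡ true) →
  𝟙 (a′ ∧ b′) ≤ 𝟙 (a ∧ b)
𝟙-∧-mono {a′ = true}  {true}  a′⇒a b′⇒b rewrite a′⇒a refl | b′⇒b refl = ≤-refl
𝟙-∧-mono {a′ = true}  {false} _ _ = z≤n
𝟙-∧-mono {a′ = false}         _ _ = z≤n

⊆⇒lookup : ∀ {k} {p q : Subset k} → p ⊆ q → ∀ y → lookup p y ≡ true → lookup q y ≡ true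
⊆⇒lookup {p = p} p⊆q y y∈p = []=⇒lookup (p⊆q (lookup⇒[]= y p y∈p))

few-mismatches⇒scaled< : ∀ r Z w w′ → 0 < r → 0 < w → 0 < w′ →
  2 * r ^ 3 * Z ≤ w → w ≤ r * r * w′ → r * (Z * w) < w * w′
few-mismatches⇒scaled< r Z w w′ r>0 w>0 w′>0 few w≤r²w′ = begin-strict
  r * (Z * w)   ≡⟨ *-assoc r Z w ⟨
  r * Z * w     <⟨ *-monoˡ-< w {{ℕ.>-nonZero w>0}} rZ<w′ ⟩
  w′ * w        ≡⟨ *-comm w′ w ⟩
  w * w′        ∎
  where
  open ≤-Reasoning
  cube : ∀ r Z → r * r * (2 * (r * Z)) ≡ 2 * (r * (r * (r * 1))) * Z
  cube = solve-∀
  2rZ≤w′ : 2 * (r * Z) ≤ w′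
  2rZ≤w′ = *-cancelˡ-≤ (r * r) {{ℕ.>-nonZero (*-mono-≤ r>0 r>0)}}
    (≤-trans (≤-reflexive (cube r Z)) (≤-trans few w≤r²w′))
  rZ<w′ : r * Z < w′
  rZ<w′ with r * Z | 2rZ≤w′
  ... | zero  | _      = w′>0
  ... | suc a | 2a≤w′ = <-≤-trans (m<m+n (suc a) (s≤s z≤n)) 2a≤w′

*-≤-+-< : ∀ R a b c D → a ≤ b + c → R * c < D → R * a < R * b + D
*-≤-+-< R a b c D a≤b+c Rc<D = begin-strict
  R * a         ≤⟨ *-monoʳ-≤ R a≤b+c ⟩
  R * (b + c)   ≡⟨ *-distribˡ-+ R b c ⟩
  R * b + R * c <⟨ +-monoʳ-< (R * b) Rc<D ⟩
  R * b + D     ∎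
  where open ≤-Reasoning

module _ {n m} (E : Rel n m) where

  blockSum : Subset n → Subset m → (Fin n → Fin m → ℕ) → ℕ
  blockSum A B φ = sumFin (λ x → sumFin (λ y → 𝟙 (lookup A x ∧ lookup B y) * φ x y))

  mismatches : Subset n → Subset m → Bool → ℕ
  mismatches A B v = blockSum A B (λ x y → 𝟙 (E x y xor v))

  blockSum-1 : ∀ A B → blockSum A B (λ _ _ → 1) ≡ ∣ A ∣ * ∣ B ∣
  blockSum-1 A B = begin
    blockSum A B (λ _ _ → 1)
      ≡⟨ sumFin-cong (λ x → sumFin-cong (λ y → trans (*-identityʳ _) (𝟙-∧ (lookup A x) (lookup B y)))) ⟩
    sumFin (λ x → sumFin (λ y → 𝟙 (lookup A x) * 𝟙 (lookup B y)))
      ≡⟨ sumFin-product (λ x → 𝟙 (lookup A x)) (λ y → 𝟙 (lookup B y)) ⟩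
    sumFin (λ x → 𝟙 (lookup A x)) * sumFin (λ y → 𝟙 (lookup B y))
      ≡⟨ cong₂ _*_ (∣∣≡sumFin A) (∣∣≡sumFin B) ⟨
    ∣ A ∣ * ∣ B ∣ ∎
    where open ≡-Reasoning

  blockSum-mono-⊆ : ∀ {A A′ B B′} φ → A′ ⊆ A → B′ ⊆ B → blockSum A′ B′ φ ≤ blockSum A B φ
  blockSum-mono-⊆ φ A′⊆A B′⊆B = sumFin-mono-≤ (λ x → sumFin-mono-≤ (λ y →
    *-monoˡ-≤ (φ x y) (𝟙-∧-mono (⊆⇒lookup A′⊆A x) (⊆⇒lookup B′⊆B y))))

  edgeCount≡mismatches-false : ∀ A B → edgeCount E A B ≡ mismatches A B false
  edgeCount≡mismatches-false A B = sumFin-cong (λ x → sumFin-cong (λ y →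
    𝟙-∧-xor-false (lookup A x) (lookup B y) (E x y)))
    where
    𝟙-∧-xor-false : ∀ a b c → 𝟙 (a ∧ b ∧ c) ≡ 𝟙 (a ∧ b) * 𝟙 (c xor false)
    𝟙-∧-xor-false true  true  true  = refl
    𝟙-∧-xor-false true  true  false = refl
    𝟙-∧-xor-false true  false c     = refl
    𝟙-∧-xor-false false b     c     = refl

  blockSum-factor : ∀ A B φ → blockSum A B φ ≡
    sumFin (λ x → 𝟙 (lookup A x) * sumFin (λ y → 𝟙 (lookup B y) * φ x y))
  blockSum-factor A B φ = sumFin-cong λ x → trans
    (sumFin-cong (λ y → trans (cong (_* φ x y) (𝟙-∧ (lookup A x) (lookup B y))) (*-assoc (𝟙 (lookup A x)) _ _)))
    (sym (*-distribˡ-sumFin (𝟙 (lookup A x)) (λ y → 𝟙 (lookup B y) * φ x y)))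

  blockSum-cong : ∀ A B {φ ψ} → (∀ x y → φ x y ≡ ψ x y) → blockSum A B φ ≡ blockSum A B ψ
  blockSum-cong A B φ≗ψ = sumFin-cong (λ x → sumFin-cong (λ y →
    cong (𝟙 (lookup A x ∧ lookup B y) *_) (φ≗ψ x y)))

  blockSum-mono-≤ : ∀ A B {φ ψ} → (∀ x y → φ x y ≤ ψ x y) → blockSum A B φ ≤ blockSum A B ψ
  blockSum-mono-≤ A B φ≤ψ = sumFin-mono-≤ (λ x → sumFin-mono-≤ (λ y →
    *-monoʳ-≤ (𝟙 (lookup A x ∧ lookup B y)) (φ≤ψ x y)))

  blockSum-distrib-+ : ∀ A B φ ψ →
    blockSum A B (λ x y → φ x y + ψ x y) ≡ blockSum A B φ + blockSum A B ψ
  blockSum-distrib-+ A B φ ψ = trans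
    (sumFin-cong (λ x → trans
      (sumFin-cong (λ y → *-distribˡ-+ (𝟙 (lookup A x ∧ lookup B y)) (φ x y) (ψ x y)))
      (sumFin-distrib-+ (λ y → 𝟙 (lookup A x ∧ lookup B y) * φ x y) _)))
    (sumFin-distrib-+ (λ x → sumFin (λ y → 𝟙 (lookup A x ∧ lookup B y) * φ x y)) _)

  edgeCount+mismatches-true : ∀ A B → edgeCount E A B + mismatches A B true ≡ ∣ A ∣ * ∣ B ∣
  edgeCount+mismatches-true A B = begin
    edgeCount E A B + mismatches A B true
      ≡⟨ cong (_+ mismatches A B true) (edgeCount≡mismatches-false A B) ⟩
    mismatches A B false + mismatches A B true
      ≡⟨ blockSum-distrib-+ A B (λ x y → 𝟙 (E x y xor false)) (λ x y → 𝟙 (E x y xor true)) ⟨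
    blockSum A B (λ x y → 𝟙 (E x y xor false) + 𝟙 (E x y xor true))
      ≡⟨ blockSum-cong A B (λ x y → xor-false+xor-true (E x y)) ⟩
    blockSum A B (λ _ _ → 1)
      ≡⟨ blockSum-1 A B ⟩
    ∣ A ∣ * ∣ B ∣ ∎
    where
    open ≡-Reasoning
    xor-false+xor-true : ∀ c → 𝟙 (c xor false) + 𝟙 (c xor true) ≡ 1
    xor-false+xor-true true  = refl
    xor-false+xor-true false = refl

  module _ {A A′ : Subset n} {B B′ : Subset m} (A′⊆A : A′ ⊆ A) (B′⊆B : B′ ⊆ B) where

    private
      e e′ w w′ : ℕ
      e  = edgeCount E A B
      e′ = edgeCount E A′ B′
      w  = ∣ A ∣ * ∣ B ∣
      w′ = ∣ A′ ∣ * ∣ B′ ∣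

    w′≤w : w′ ≤ w
    w′≤w = *-mono-≤ (p⊆q⇒∣p∣≤∣q∣ A′⊆A) (p⊆q⇒∣p∣≤∣q∣ B′⊆B)

    mismatches-mono : ∀ v → mismatches A′ B′ v ≤ mismatches A B v
    mismatches-mono v = blockSum-mono-⊆ (λ x y → 𝟙 (E x y xor v)) A′⊆A B′⊆B

    -- |e/w - e′/w′| ≤ Z/w′ for Z the mismatches with v, cleared of denominators.
    mismatch-sandwich : ∀ v →
      e * w′ ≤ e′ * w + mismatches A B v * w × e′ * w ≤ e * w′ + mismatches A B v * w
    mismatch-sandwich false = below , above
      where
      open ≤-Reasoning
      below : e * w′ ≤ e′ * w + mismatches A B false * w
      below = begin
        e * w′                          ≡⟨ cong (_* w′) (edgeCount≡mismatches-false A B) ⟩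
        mismatches A B false * w′       ≤⟨ *-monoʳ-≤ (mismatches A B false) w′≤w ⟩
        mismatches A B false * w        ≤⟨ m≤n+m _ _ ⟩
        e′ * w + mismatches A B false * w ∎
      above : e′ * w ≤ e * w′ + mismatches A B false * w
      above = begin
        e′ * w                          ≡⟨ cong (_* w) (edgeCount≡mismatches-false A′ B′) ⟩
        mismatches A′ B′ false * w      ≤⟨ *-monoˡ-≤ w (mismatches-mono false) ⟩
        mismatches A B false * w        ≤⟨ m≤n+m _ _ ⟩
        e * w′ + mismatches A B false * w ∎
    mismatch-sandwich true = below , above
      where
      open ≤-Reasoning
      below : e * w′ ≤ e′ * w + mismatches A B true * w
      below = begin
        e * w′                                     ≤⟨ *-monoˡ-≤ w′ (m≤m+n e _) ⟩
        (e + mismatches A B true) * w′             ≡⟨ cong (_* w′) (edgeCount+mismatches-true A B) ⟩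
        w * w′                                     ≡⟨ *-comm w w′ ⟩
        w′ * w                                     ≡⟨ cong (_* w) (edgeCount+mismatches-true A′ B′) ⟨
        (e′ + mismatches A′ B′ true) * w           ≡⟨ *-distribʳ-+ w e′ _ ⟩
        e′ * w + mismatches A′ B′ true * w         ≤⟨ +-monoʳ-≤ (e′ * w) (*-monoˡ-≤ w (mismatches-mono true)) ⟩
        e′ * w + mismatches A B true * w           ∎
      above : e′ * w ≤ e * w′ + mismatches A B true * w
      above = begin
        e′ * w                                     ≤⟨ *-monoˡ-≤ w (m≤m+n e′ _) ⟩
        (e′ + mismatches A′ B′ true) * w           ≡⟨ cong (_* w) (edgeCount+mismatches-true A′ B′) ⟩
        w′ * w                                     ≡⟨ *-comm w′ w ⟩
        w * w′                                     ≡⟨ cong (_* w′) (edgeCount+mismatches-true A B) ⟨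
        (e + mismatches A B true) * w′             ≡⟨ *-distribʳ-+ w′ e _ ⟩
        e * w′ + mismatches A B true * w′          ≤⟨ +-monoʳ-≤ (e * w′) (*-monoʳ-≤ (mismatches A B true) w′≤w) ⟩
        e * w′ + mismatches A B true * w           ∎

  nearly-constant⇒regular : ∀ r (A : Subset n) (B : Subset m) v → 0 < ∣ A ∣ → 0 < ∣ B ∣ →
    2 * suc r ^ 3 * mismatches A B v ≤ ∣ A ∣ * ∣ B ∣ → RegularPair (frac 1 (suc r)) E A B
  nearly-constant⇒regular r A B v A>0 B>0 few A′ B′ A′⊆A B′⊆B A′-large B′-large =
    ∣frac-frac∣<ε r e w e′ w′ w>0 w′>0
      (*-≤-+-< (suc r) (e * w′) (e′ * w) (Z * w) (w * w′) below scaled<)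
      (*-≤-+-< (suc r) (e′ * w) (e * w′) (Z * w) (w′ * w) above (subst (suc r * (Z * w) <_) (*-comm w w′) scaled<))
    where
    e e′ w w′ Z : ℕ
    e  = edgeCount E A B
    e′ = edgeCount E A′ B′
    w  = ∣ A ∣ * ∣ B ∣
    w′ = ∣ A′ ∣ * ∣ B′ ∣
    Z  = mismatches A B v
    below : e * w′ ≤ e′ * w + Z * w
    below = proj₁ (mismatch-sandwich A′⊆A B′⊆B v)
    above : e′ * w ≤ e * w′ + Z * w
    above = proj₂ (mismatch-sandwich A′⊆A B′⊆B v)
    A≤rA′ : ∣ A ∣ ≤ suc r * ∣ A′ ∣
    A≤rA′ = ε-fraction⇒≤ r n ∣ A ∣ ∣ A′ ∣ (<-≤-trans A>0 (∣p∣≤n A)) A′-large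
    B≤rB′ : ∣ B ∣ ≤ suc r * ∣ B′ ∣
    B≤rB′ = ε-fraction⇒≤ r m ∣ B ∣ ∣ B′ ∣ (<-≤-trans B>0 (∣p∣≤n B)) B′-large
    w≤r²w′ : w ≤ suc r * suc r * w′
    w≤r²w′ = ≤-trans (*-mono-≤ A≤rA′ B≤rB′) (≤-reflexive (interchange (suc r) ∣ A′ ∣ ∣ B′ ∣))
      where
      interchange : ∀ r a b → r * a * (r * b) ≡ r * r * (a * b)
      interchange = solve-∀
    w>0 : 0 < w
    w>0 = *-mono-≤ A>0 B>0
    w′>0 : 0 < w′
    w′>0 = *-mono-≤ (positive A≤rA′ A>0) (positive B≤rB′ B>0)
      where
      positive : ∀ {a a′} → a ≤ suc r * a′ → 0 < a → 0 < a′
      positive {a′ = suc _} _ _ = s≤s z≤n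
      positive {a′ = zero} a≤0 a>0 = contradiction (≤-trans a≤0 (≤-reflexive (*-zeroʳ (suc r)))) (<⇒≱ a>0)
    scaled< : suc r * (Z * w) < w * w′
    scaled< = few-mismatches⇒scaled< (suc r) Z w w′ (s≤s z≤n) w>0 w′>0 few w≤r²w′

-- Regularity of the partition into clusters

lookup-piece : ∀ {n} (P : Partition n) i x → lookup (piece P i) x ≡ ⌊ assign P x Fin.≟ i ⌋
lookup-piece P i x = lookup∘tabulate _ x

0<∣piece∣ : ∀ {n} (P : Partition n) i → 0 < ∣ piece P i ∣
0<∣piece∣ P i with x , x∈Pᵢ ← nonempty P i = begin
  1                                       ≡⟨ cong 𝟙 (trans (lookup-piece P i x) (⌊⌋≡true (assign P x Fin.≟ i) x∈Pᵢ)) ⟨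
  𝟙 (lookup (piece P i) x)                ≤⟨ ≤-sumFin (λ x → 𝟙 (lookup (piece P i) x)) x ⟩
  sumFin (λ x → 𝟙 (lookup (piece P i) x)) ≡⟨ ∣∣≡sumFin (piece P i) ⟨
  ∣ piece P i ∣                           ∎
  where open ≤-Reasoning

sumFin-pieces : ∀ {n} (P : Partition n) (φ : Fin (parts P) → Fin n → ℕ) →
  sumFin (λ i → sumFin (λ x → 𝟙 (lookup (piece P i) x) * φ i x)) ≡ sumFin (λ x → φ (assign P x) x)
sumFin-pieces P φ = trans (sumFin-comm (λ i x → 𝟙 (lookup (piece P i) x) * φ i x))
  (sumFin-cong λ x → trans (sumFin-cong (λ i → cong (λ b → 𝟙 b * φ i x) (lookup-piece P i x)))
    (sumFin-δ (assign P x) (λ i → φ i x)))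

sumFin-blocks : ∀ {n m} (E : Rel n m) (PX : Partition n) (PY : Partition m)
  (φ : Fin (parts PX) → Fin (parts PY) → Fin n → Fin m → ℕ) →
  sumFin (λ i → sumFin (λ j → blockSum E (piece PX i) (piece PY j) (φ i j))) ≡
  sumFin (λ x → sumFin (λ y → φ (assign PX x) (assign PY y) x y))
sumFin-blocks {n} {m} E PX PY φ = begin
  sumFin (λ i → sumFin (λ j → blockSum E (A i) (B j) (φ i j)))
    ≡⟨ sumFin-cong (λ i → sumFin-cong (λ j → blockSum-factor E (A i) (B j) (φ i j))) ⟩
  sumFin (λ i → sumFin (λ j → sumFin (λ x → 𝟙 (lookup (A i) x) * inner i j x)))
    ≡⟨ sumFin-cong (λ i → sumFin-comm (λ j x → 𝟙 (lookup (A i) x) * inner i j x)) ⟩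
  sumFin (λ i → sumFin (λ x → sumFin (λ j → 𝟙 (lookup (A i) x) * inner i j x)))
    ≡⟨ sumFin-cong (λ i → sumFin-cong (λ x → sym (*-distribˡ-sumFin (𝟙 (lookup (A i) x)) (λ j → inner i j x)))) ⟩
  sumFin (λ i → sumFin (λ x → 𝟙 (lookup (A i) x) * sumFin (λ j → inner i j x)))
    ≡⟨ sumFin-cong (λ i → sumFin-cong (λ x → cong (𝟙 (lookup (A i) x) *_)
         (sumFin-pieces PY (λ j y → φ i j x y)))) ⟩
  sumFin (λ i → sumFin (λ x → 𝟙 (lookup (A i) x) * sumFin (λ y → φ i (assign PY y) x y)))
    ≡⟨ sumFin-pieces PX (λ i x → sumFin (λ y → φ i (assign PY y) x y)) ⟩
  sumFin (λ x → sumFin (λ y → φ (assign PX x) (assign PY y) x y)) ∎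
  where
  open ≡-Reasoning
  A : Fin (parts PX) → Subset n
  A = piece PX
  B : Fin (parts PY) → Subset m
  B = piece PY
  inner : Fin (parts PX) → Fin (parts PY) → Fin n → ℕ
  inner i j x = sumFin (λ y → 𝟙 (lookup (B j) y) * φ i j x y)

𝟙-xor-triangle : ∀ a b c → 𝟙 (a xor b) ≤ 𝟙 (a xor c) + 𝟙 (c xor b)
𝟙-xor-triangle true  true  c     = z≤n
𝟙-xor-triangle false false c     = z≤n
𝟙-xor-triangle true  false true  = s≤s z≤n
𝟙-xor-triangle true  false false = s≤s z≤n
𝟙-xor-triangle false true  true  = s≤s z≤n
𝟙-xor-triangle false true  false = ≤-refl

module ClusterRegularity {n m} (E : Rel n m) (r t : ℕ) (PX : Partition n) (PY : Partition m)
  (cX : Fin (parts PX) → Fin n) (cY : Fin (parts PY) → Fin m)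
  (rows-close : ∀ x → Close E t x (cX (assign PX x)))
  (columns-close : ∀ y → Close (transposeRel E) t y (cY (assign PY y)))
  (t-large : 2 * suc r ^ 3 * 3 * suc r ≤ t) where

  A : Fin (parts PX) → Subset n
  A = piece PX
  B : Fin (parts PY) → Subset m
  B = piece PY

  centreRow : Fin (parts PX) → Fin m → Bool
  centreRow i y = E (cX i) y
  centreColumn : Fin (parts PY) → Fin n → Bool
  centreColumn j x = E x (cY j)

  rowMismatches : Fin (parts PX) → Fin (parts PY) → Bool → ℕ
  rowMismatches i j v = sumFin (λ y → 𝟙 (lookup (B j) y) * 𝟙 (centreRow i y xor v))

  majority : Fin (parts PX) → Fin (parts PY) → Bool
  majority i j = ⌊ rowMismatches i j true ≤? rowMismatches i j false ⌋

  majority-minimal : ∀ i j v → rowMismatches i j (majority i j) ≤ rowMismatches i j v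
  majority-minimal i j v with rowMismatches i j true ≤? rowMismatches i j false | v
  ... | yes true≤false | true  = ≤-refl
  ... | yes true≤false | false = true≤false
  ... | no  true≰false | true  = <⇒≤ (≰⇒> true≰false)
  ... | no  true≰false | false = ≤-refl

  blockError : Fin (parts PX) → Fin (parts PY) → ℕ
  blockError i j = blockSum E (A i) (B j) (λ x y → 𝟙 (E x y xor centreRow i y) + 𝟙 (centreRow i y xor centreColumn j x))

  -- Compare E with the centre row g, then g with v; v is the value of g's majority on B j, so it
  -- disagrees with g no more often than any column value E x (cY j) does.
  mismatches≤blockError : ∀ i j → mismatches E (A i) (B j) (majority i j) ≤ blockError i j
  mismatches≤blockError i j = begin
    mismatches E (A i) (B j) (majority i j)
      ≤⟨ blockSum-mono-≤ E (A i) (B j) (λ x y → 𝟙-xor-triangle (E x y) (majority i j) (centreRow i y)) ⟩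
    blockSum E (A i) (B j) (λ x y → 𝟙 (E x y xor centreRow i y) + 𝟙 (centreRow i y xor majority i j))
      ≡⟨ blockSum-distrib-+ E (A i) (B j) (λ x y → 𝟙 (E x y xor centreRow i y)) _ ⟩
    viaRow + blockSum E (A i) (B j) (λ x y → 𝟙 (centreRow i y xor majority i j))
      ≡⟨ cong (viaRow +_) (blockSum-factor E (A i) (B j) _) ⟩
    viaRow + sumFin (λ x → 𝟙 (lookup (A i) x) * rowMismatches i j (majority i j))
      ≤⟨ +-monoʳ-≤ viaRow (sumFin-mono-≤ (λ x →
           *-monoʳ-≤ (𝟙 (lookup (A i) x)) (majority-minimal i j (centreColumn j x)))) ⟩
    viaRow + sumFin (λ x → 𝟙 (lookup (A i) x) * rowMismatches i j (centreColumn j x))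
      ≡⟨ cong (viaRow +_) (blockSum-factor E (A i) (B j) _) ⟨
    viaRow + blockSum E (A i) (B j) (λ x y → 𝟙 (centreRow i y xor centreColumn j x))
      ≡⟨ blockSum-distrib-+ E (A i) (B j) (λ x y → 𝟙 (E x y xor centreRow i y)) _ ⟨
    blockError i j ∎
    where
    open ≤-Reasoning
    viaRow : ℕ
    viaRow = blockSum E (A i) (B j) (λ x y → 𝟙 (E x y xor centreRow i y))

  threshold : ℕ
  threshold = 2 * suc r ^ 3

  weight : Fin (parts PX) → Fin (parts PY) → ℕ
  weight i j = ∣ A i ∣ * ∣ B j ∣

  bad : Fin (parts PX) → Fin (parts PY) → Bool
  bad i j = not ⌊ threshold * blockError i j ≤? weight i j ⌋

  good⇒regular : ∀ i j → bad i j ≡ false → RegularPair (frac 1 (suc r)) E (A i) (B j)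
  good⇒regular i j good = nearly-constant⇒regular E r (A i) (B j) (majority i j) (0<∣piece∣ PX i) (0<∣piece∣ PY j)
    (≤-trans (*-monoʳ-≤ threshold (mismatches≤blockError i j))
             (not⌊⌋≡false⁻ (threshold * blockError i j ≤? weight i j) good))

  badWeight totalError : ℕ
  badWeight  = sumFin (λ i → sumFin (λ j → 𝟙 (bad i j) * weight i j))
  totalError = sumFin (λ i → sumFin (λ j → blockError i j))

  badWeight≤ : badWeight ≤ threshold * totalError
  badWeight≤ = begin
    badWeight
      ≤⟨ sumFin-mono-≤ (λ i → sumFin-mono-≤ (λ j → bad-weight i j)) ⟩
    sumFin (λ i → sumFin (λ j → threshold * blockError i j))
      ≡⟨ sumFin-cong (λ i → *-distribˡ-sumFin threshold (blockError i)) ⟨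
    sumFin (λ i → threshold * sumFin (blockError i))
      ≡⟨ *-distribˡ-sumFin threshold (λ i → sumFin (blockError i)) ⟨
    threshold * totalError ∎
    where
    open ≤-Reasoning
    bad-weight : ∀ i j → 𝟙 (bad i j) * weight i j ≤ threshold * blockError i j
    bad-weight i j with threshold * blockError i j ≤? weight i j
    ... | yes _ = z≤n
    ... | no  ≰ = ≤-trans (≤-reflexive (+-identityʳ _)) (<⇒≤ (≰⇒> ≰))

  rowErrors columnErrors : ℕ
  rowErrors    = sumFin (λ x → rowDist E x (cX (assign PX x)))
  columnErrors = sumFin (λ y → rowDist (transposeRel E) y (cY (assign PY y)))

  rowErrors-bound : suc t * rowErrors ≤ n * m
  rowErrors-bound = ≤-trans (≤-reflexive (*-distribˡ-sumFin (suc t) (λ x → rowDist E x (cX (assign PX x)))))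
                            (sumFin-≤-bound m rows-close)

  columnErrors-bound : suc t * columnErrors ≤ m * n
  columnErrors-bound = ≤-trans (≤-reflexive (*-distribˡ-sumFin (suc t) (λ y → rowDist (transposeRel E) y (cY (assign PY y)))))
                               (sumFin-≤-bound n columns-close)

  totalError≤ : totalError ≤ rowErrors + rowErrors + columnErrors
  totalError≤ = begin
    totalError
      ≡⟨ sumFin-blocks E PX PY (λ i j x y → 𝟙 (E x y xor centreRow i y) + 𝟙 (centreRow i y xor centreColumn j x)) ⟩
    sumFin (λ x → sumFin (λ y → 𝟙 (g x y) + 𝟙 (centreRow (assign PX x) y xor centreColumn (assign PY y) x)))
      ≤⟨ sumFin-mono-≤ (λ x → sumFin-mono-≤ (λ y → +-monoʳ-≤ (𝟙 (g x y)) (via-E x y))) ⟩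
    sumFin (λ x → sumFin (λ y → 𝟙 (g x y) + (𝟙 (g x y) + 𝟙 (h x y))))
      ≡⟨ sumFin-cong (λ x → trans (sumFin-distrib-+ (λ y → 𝟙 (g x y)) _)
                                  (cong (rowDist E x (cX (assign PX x)) +_) (sumFin-distrib-+ (λ y → 𝟙 (g x y)) _))) ⟩
    sumFin (λ x → rowDist E x (cX (assign PX x)) + (rowDist E x (cX (assign PX x)) + sumFin (λ y → 𝟙 (h x y))))
      ≡⟨ trans (sumFin-distrib-+ (λ x → rowDist E x (cX (assign PX x))) _)
               (cong (rowErrors +_) (sumFin-distrib-+ (λ x → rowDist E x (cX (assign PX x))) _)) ⟩
    rowErrors + (rowErrors + sumFin (λ x → sumFin (λ y → 𝟙 (h x y))))
      ≡⟨ cong (λ z → rowErrors + (rowErrors + z)) (sumFin-comm (λ x y → 𝟙 (h x y))) ⟩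
    rowErrors + (rowErrors + columnErrors)
      ≡⟨ +-assoc rowErrors rowErrors columnErrors ⟨
    rowErrors + rowErrors + columnErrors ∎
    where
    open ≤-Reasoning
    g h : Fin n → Fin m → Bool
    g x y = E x y xor centreRow (assign PX x) y
    h x y = E x y xor centreColumn (assign PY y) x
    via-E : ∀ x y → 𝟙 (centreRow (assign PX x) y xor centreColumn (assign PY y) x) ≤ 𝟙 (g x y) + 𝟙 (h x y)
    via-E x y = ≤-trans (𝟙-xor-triangle (centreRow (assign PX x) y) (centreColumn (assign PY y) x) (E x y))
      (≤-reflexive (cong (λ b → 𝟙 b + 𝟙 (h x y)) (xor-comm (centreRow (assign PX x) y) (E x y))))

  totalError-bound : suc t * totalError ≤ 3 * (n * m)
  totalError-bound = begin
    suc t * totalError                                      ≤⟨ *-monoʳ-≤ (suc t) totalError≤ ⟩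
    suc t * (rowErrors + rowErrors + columnErrors)          ≡⟨ distribute (suc t) rowErrors columnErrors ⟩
    suc t * rowErrors + suc t * rowErrors + suc t * columnErrors
      ≤⟨ +-mono-≤ (+-mono-≤ rowErrors-bound rowErrors-bound) columnErrors-bound ⟩
    n * m + n * m + m * n                                   ≡⟨ collect n m ⟩
    3 * (n * m)                                             ∎
    where
    open ≤-Reasoning
    distribute : ∀ t a b → t * (a + a + b) ≡ t * a + t * a + t * b
    distribute = solve-∀
    collect : ∀ n m → n * m + n * m + m * n ≡ 3 * (n * m)
    collect = solve-∀

  -- The bad blocks carry at most 2r³·3/(t+1) < 1/r of the total weight nm.
  badWeight-small : 0 < n * m → badWeight * suc r < n * m
  badWeight-small nm>0 = *-cancelˡ-< (suc t) (badWeight * suc r) (n * m) (begin-strict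
    suc t * (badWeight * suc r)               ≤⟨ *-monoʳ-≤ (suc t) (*-monoˡ-≤ (suc r) badWeight≤) ⟩
    suc t * (threshold * totalError * suc r)  ≡⟨ regroup (suc t) threshold totalError (suc r) ⟩
    threshold * suc r * (suc t * totalError)  ≤⟨ *-monoʳ-≤ (threshold * suc r) totalError-bound ⟩
    threshold * suc r * (3 * (n * m))         ≡⟨ regroup′ threshold (suc r) (n * m) ⟩
    threshold * 3 * suc r * (n * m)           ≤⟨ *-monoˡ-≤ (n * m) t-large ⟩
    t * (n * m)                               <⟨ *-monoˡ-< (n * m) {{ℕ.>-nonZero nm>0}} (n<1+n t) ⟩
    suc t * (n * m)                           ∎)
    where
    open ≤-Reasoning
    regroup : ∀ t k a r → t * (k * a * r) ≡ k * r * (t * a)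
    regroup = solve-∀
    regroup′ : ∀ k r x → k * r * (3 * x) ≡ k * 3 * r * x
    regroup′ = solve-∀

  badMeasure≡ : sumFinℚ (λ i → sumFinℚ (λ j → if bad i j then μ (A i) ℚ.* μ (B j) else ℚ.0ℚ))
              ≡ frac badWeight (n * m)
  badMeasure≡ = trans
    (sumFinℚ-cong (λ i → trans (sumFinℚ-cong (λ j → frac*frac-masked n m ∣ A i ∣ ∣ B j ∣ (bad i j)))
                               (sumFinℚ-frac (n * m) (λ j → 𝟙 (bad i j) * weight i j))))
    (sumFinℚ-frac (n * m) (λ i → sumFin (λ j → 𝟙 (bad i j) * weight i j)))

  regular : RegularPartition (frac 1 (suc r)) E PX PY
  regular = bad , good⇒regular ,
    subst (ℚ._< frac 1 (suc r)) (sym badMeasure≡) (frac<1/r r (n * m) badWeight badWeight-small)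

n<2^n : ∀ n → n < 2 ^ n
n<2^n zero    = s≤s z≤n
n<2^n (suc n) = ≤-trans (+-mono-≤ (m^n>0 2 n) (n<2^n n)) (≤-reflexive (cong (2 ^ n +_) (sym (+-identityʳ (2 ^ n)))))

^-suc+1≤ : ∀ a j → a ^ suc j + 1 ≤ suc a ^ suc j
^-suc+1≤ a zero    = ≤-reflexive (base a)
  where
  base : ∀ a → a * 1 + 1 ≡ (1 + a) * 1
  base = solve-∀
^-suc+1≤ a (suc j) = ≤-trans (≤-trans (m≤m+n (a * a ^ suc j + 1) (a ^ suc j + a)) (≤-reflexive (step a (a ^ suc j))))
                             (*-monoʳ-≤ (suc a) (^-suc+1≤ a j))
  where
  step : ∀ a x → a * x + 1 + (x + a) ≡ (1 + a) * (x + 1)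
  step = solve-∀

bernoulli : ∀ a k → a ^ k * (a + k) ≤ a * suc a ^ k
bernoulli a zero    = ≤-reflexive (base a)
  where
  base : ∀ a → 1 * (a + 0) ≡ a * 1
  base = solve-∀
bernoulli a (suc k) = begin
  a * a ^ k * (a + suc k)                  ≤⟨ m≤m+n _ (a ^ k * k) ⟩
  a * a ^ k * (a + suc k) + a ^ k * k      ≡⟨ step a (a ^ k) k ⟩
  suc a * (a ^ k * (a + k))                ≤⟨ *-monoʳ-≤ (suc a) (bernoulli a k) ⟩
  suc a * (a * suc a ^ k)                  ≡⟨ swap (suc a) a (suc a ^ k) ⟩
  a * (suc a * suc a ^ k)                  ∎
  where
  open ≤-Reasoning
  step : ∀ a p k → a * p * (a + (1 + k)) + p * k ≡ (1 + a) * (p * (a + k))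
  step = solve-∀
  swap : ∀ b a p → b * (a * p) ≡ a * (b * p)
  swap = solve-∀

2*a^a≤suc-a^a : ∀ a → 0 < a → 2 * a ^ a ≤ suc a ^ a
2*a^a≤suc-a^a a@(suc _) _ = *-cancelˡ-≤ a (≤-trans (≤-reflexive (double a (a ^ a))) (bernoulli a a))
  where
  double : ∀ a p → a * (2 * p) ≡ p * (a + a)
  double = solve-∀

2^u*a^au≤suc-a^au : ∀ a u → 0 < a → 2 ^ u * a ^ (a * u) ≤ suc a ^ (a * u)
2^u*a^au≤suc-a^au a u a>0 = begin
  2 ^ u * a ^ (a * u)    ≡⟨ cong (2 ^ u *_) (^-*-assoc a a u) ⟨
  2 ^ u * (a ^ a) ^ u    ≡⟨ ^-distribʳ-* 2 (a ^ a) u ⟨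
  (2 * a ^ a) ^ u        ≤⟨ ^-monoˡ-≤ u (2*a^a≤suc-a^a a a>0) ⟩
  (suc a ^ a) ^ u        ≡⟨ ^-*-assoc (suc a) a u ⟩
  suc a ^ (a * u)        ∎
  where open ≤-Reasoning

3*q*q<4^q : ∀ q → 3 * q * q < 4 ^ q
3*q*q<4^q zero          = s≤s z≤n
3*q*q<4^q (suc zero)    = s≤s (s≤s (s≤s (s≤s z≤n)))
3*q*q<4^q (suc (suc q)) = ≤-<-trans (≤-trans (m≤m+n _ (9 * q * q + 12 * q)) (≤-reflexive (step q)))
                                    (*-monoʳ-< 4 (3*q*q<4^q (suc q)))
  where
  step : ∀ q → 3 * (2 + q) * (2 + q) + (9 * q * q + 12 * q) ≡ 4 * (3 * (1 + q) * (1 + q))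
  step = solve-∀

module SampleSize (t d : ℕ) where

  q s e B : ℕ
  q = t + 2 * d + 3
  s = t * 4 ^ q
  e = t + 2 * q + 1
  B = suc s ^ suc d

  2+s≤2^e : 1 ≤ t → 2 + s ≤ 2 ^ e
  2+s≤2^e t≥1 = begin
    2 + s                                 ≡⟨ +-comm 2 s ⟩
    t * 4 ^ q + 2                         ≤⟨ +-mono-≤ (*-mono-≤ (<⇒≤ (n<2^n t)) (≤-reflexive (^-*-assoc 2 2 q)))
                                                      (^-monoʳ-≤ 2 {1} {t + 2 * q} (≤-trans t≥1 (m≤m+n t (2 * q)))) ⟩
    2 ^ t * 2 ^ (2 * q) + 2 ^ (t + 2 * q) ≡⟨ cong (_+ 2 ^ (t + 2 * q)) (^-distribˡ-+-* 2 t (2 * q)) ⟨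
    2 ^ (t + 2 * q) + 2 ^ (t + 2 * q)     ≡⟨ double (2 ^ (t + 2 * q)) ⟩
    2 ^ suc (t + 2 * q)                   ≡⟨ cong (2 ^_) (+-comm 1 (t + 2 * q)) ⟩
    2 ^ e                                 ∎
    where
    open ≤-Reasoning
    double : ∀ x → x + x ≡ 2 * x
    double = solve-∀

  B≤2^[e*suc-d] : 1 ≤ t → B ≤ 2 ^ (e * suc d)
  B≤2^[e*suc-d] t≥1 = ≤-trans (^-monoˡ-≤ (suc d) (≤-trans (n≤1+n (suc s)) (2+s≤2^e t≥1)))
                              (≤-reflexive (^-*-assoc 2 e (suc d)))

  [1+B]²≤2^[e*2[suc-d]] : 1 ≤ t → suc B * suc B ≤ 2 ^ (e * (2 * suc d))
  [1+B]²≤2^[e*2[suc-d]] t≥1 = begin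
    suc B * suc B                       ≤⟨ *-mono-≤ 1+B≤ 1+B≤ ⟩
    2 ^ (e * suc d) * 2 ^ (e * suc d)   ≡⟨ ^-distribˡ-+-* 2 (e * suc d) (e * suc d) ⟨
    2 ^ (e * suc d + e * suc d)         ≡⟨ cong (2 ^_) (double e (suc d)) ⟩
    2 ^ (e * (2 * suc d))               ∎
    where
    open ≤-Reasoning
    double : ∀ e d → e * d + e * d ≡ e * (2 * d)
    double = solve-∀
    1+B≤ : suc B ≤ 2 ^ (e * suc d)
    1+B≤ = ≤-trans (≤-reflexive (+-comm 1 B)) (≤-trans (^-suc+1≤ (suc s) d)
             (≤-trans (^-monoˡ-≤ (suc d) (2+s≤2^e t≥1)) (≤-reflexive (^-*-assoc 2 e (suc d)))))

  e*2[suc-d]<4^q : e * (2 * suc d) < 4 ^ q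
  e*2[suc-d]<4^q = ≤-<-trans (*-mono-≤ e≤3q 2[suc-d]≤q) (3*q*q<4^q q)
    where
    e≤3q : e ≤ 3 * q
    e≤3q = ≤-trans (m≤m+n e (2 * d + 2)) (≤-reflexive (expand t d))
      where
      expand : ∀ t d → t + 2 * (t + 2 * d + 3) + 1 + (2 * d + 2) ≡ 3 * (t + 2 * d + 3)
      expand = solve-∀
    2[suc-d]≤q : 2 * suc d ≤ q
    2[suc-d]≤q = ≤-trans (m≤n+m (2 * suc d) (t + 1)) (≤-reflexive (expand t d))
      where
      expand : ∀ t d → t + 1 + 2 * (1 + d) ≡ t + 2 * d + 3
      expand = solve-∀

  -- (1 + 1/t)^s ≥ 2^(4^q), while (B + 1)² ≤ 2^(e·2(d+1)) and e·2(d+1) < 4^q.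
  sample-large-enough : 1 ≤ t → suc B * suc B * t ^ s < suc t ^ s
  sample-large-enough t≥1 = begin-strict
    suc B * suc B * t ^ s           ≤⟨ *-monoˡ-≤ (t ^ s) ([1+B]²≤2^[e*2[suc-d]] t≥1) ⟩
    2 ^ (e * (2 * suc d)) * t ^ s   <⟨ *-monoˡ-< (t ^ s) {{ℕ.>-nonZero (m^n>0 t {{ℕ.>-nonZero t≥1}} s)}}
                                         (^-monoʳ-< 2 (s≤s (s≤s z≤n)) e*2[suc-d]<4^q) ⟩
    2 ^ 4 ^ q * t ^ s               ≤⟨ 2^u*a^au≤suc-a^au t (4 ^ q) t≥1 ⟩
    suc t ^ s                       ∎
    where open ≤-Reasoning

exponent-bound : ∀ r d → 1 ≤ r → 2 ≤ d →
  SampleSize.e (2 * r ^ 3 * 3 * r) d * suc d ≤ expo d r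
exponent-bound r d r≥1 d≥2 = begin
  (t + 2 * (t + 2 * d + 3) + 1) * suc d              ≡⟨ cong (_* suc d) (expand r d) ⟩
  (18 * R + 4 * d + 7) * suc d                       ≤⟨ *-mono-≤ terms≤ (≤-trans (≤-reflexive (+-comm 1 d)) (+-monoʳ-≤ d d≥1)) ⟩
  (18 * (R * d) + 4 * (R * d) + 7 * (R * d)) * (d + d) ≡⟨ collect R d ⟩
  d * d * (58 * R)                                   ≤⟨ *-monoʳ-≤ (d * d) 58R≤ ⟩
  d * d * d ^ (1998 * r ^ 7)                         ≡⟨ cong (λ z → d * z * d ^ (1998 * r ^ 7)) (*-identityʳ d) ⟨
  d ^ 2 * d ^ (1998 * r ^ 7)                         ≡⟨ ^-distribˡ-+-* d 2 (1998 * r ^ 7) ⟨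
  d ^ (2 + 1998 * r ^ 7)                             ≤⟨ ^-monoʳ-≤ d {{ℕ.>-nonZero d≥1}} 2+1998r⁷≤ ⟩
  d ^ (2000 * r ^ 7)                                 ∎
  where
  open ≤-Reasoning
  t R : ℕ
  t = 2 * r ^ 3 * 3 * r
  R = r ^ 4
  d≥1 : 1 ≤ d
  d≥1 = ≤-trans (s≤s z≤n) d≥2
  R≥1 : 1 ≤ R
  R≥1 = m^n>0 r {{ℕ.>-nonZero r≥1}} 4
  Rd≥1 : 1 ≤ R * d
  Rd≥1 = *-mono-≤ R≥1 d≥1
  expand : ∀ r d → 2 * (r * (r * (r * 1))) * 3 * r + 2 * (2 * (r * (r * (r * 1))) * 3 * r + 2 * d + 3) + 1
                 ≡ 18 * (r * (r * (r * (r * 1)))) + 4 * d + 7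
  expand = solve-∀
  terms≤ : 18 * R + 4 * d + 7 ≤ 18 * (R * d) + 4 * (R * d) + 7 * (R * d)
  terms≤ = +-mono-≤ (+-mono-≤ (*-monoʳ-≤ 18 (m≤m*n R d {{ℕ.>-nonZero d≥1}}))
                              (*-monoʳ-≤ 4 (m≤n*m d R {{ℕ.>-nonZero R≥1}})))
                    (*-monoʳ-≤ 7 Rd≥1)
  collect : ∀ R d → (18 * (R * d) + 4 * (R * d) + 7 * (R * d)) * (d + d) ≡ d * d * (58 * R)
  collect = solve-∀
  58R≤ : 58 * R ≤ d ^ (1998 * r ^ 7)
  58R≤ = begin
    58 * R                ≤⟨ *-mono-≤ (m≤m+n 58 1940)
                                      (^-monoʳ-≤ r {{ℕ.>-nonZero r≥1}} {4} {7} (s≤s (s≤s (s≤s (s≤s z≤n))))) ⟩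
    1998 * r ^ 7          ≤⟨ <⇒≤ (n<2^n (1998 * r ^ 7)) ⟩
    2 ^ (1998 * r ^ 7)    ≤⟨ ^-monoˡ-≤ (1998 * r ^ 7) d≥2 ⟩
    d ^ (1998 * r ^ 7)    ∎
  2+1998r⁷≤ : 2 + 1998 * r ^ 7 ≤ 2000 * r ^ 7
  2+1998r⁷≤ = ≤-trans (+-monoˡ-≤ (1998 * r ^ 7) (*-monoʳ-≤ 2 (m^n>0 r {{ℕ.>-nonZero r≥1}} 7)))
                      (≤-reflexive (sum-coefficients (r ^ 7)))
    where
    sum-coefficients : ∀ x → 2 * x + 1998 * x ≡ 2000 * x
    sum-coefficients = solve-∀

-- The logarithmic form of the bound

0≤frac : ∀ a D → 0ℚ ℚ.≤ frac a D
0≤frac a zero    = ℚ.≤-refl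
0≤frac a (suc D) = frac-≤ 0 0 a D z≤n

frac1≤1 : ∀ D → frac 1 D ℚ.≤ 1ℚ
frac1≤1 zero    = frac-≤ 0 0 1 0 z≤n
frac1≤1 (suc D) = frac-≤ 1 D 1 0 (s≤s z≤n)

0≤^ℚ : ∀ a k → 0ℚ ℚ.≤ a → 0ℚ ℚ.≤ a ^ℚ k
0≤^ℚ a zero    _   = frac-≤ 0 0 1 0 z≤n
0≤^ℚ a (suc k) 0≤a = subst (ℚ._≤ a ℚ.* (a ^ℚ k)) (ℚ.*-zeroʳ a)
  (ℚ.*-monoˡ-≤-nonNeg a {{ℚ.nonNegative 0≤a}} (0≤^ℚ a k 0≤a))

^ℚ-monoˡ-≤ : ∀ k {a b} → 0ℚ ℚ.≤ a → a ℚ.≤ b → a ^ℚ k ℚ.≤ b ^ℚ k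
^ℚ-monoˡ-≤ zero    _   _   = ℚ.≤-refl
^ℚ-monoˡ-≤ (suc k) {a} {b} 0≤a a≤b = ℚ.≤-trans
  (ℚ.*-monoˡ-≤-nonNeg a {{ℚ.nonNegative 0≤a}} (^ℚ-monoˡ-≤ k 0≤a a≤b))
  (ℚ.*-monoʳ-≤-nonNeg (b ^ℚ k) {{ℚ.nonNegative (0≤^ℚ b k (ℚ.≤-trans 0≤a a≤b))}} a≤b)

frac^ℚ : ∀ a k → frac a 1 ^ℚ k ≡ frac (a ^ k) 1
frac^ℚ a zero    = refl
frac^ℚ a (suc k) = trans (cong (frac a 1 ℚ.*_) (frac^ℚ a k)) (frac-* a 0 (a ^ k) 0)

private
  ½ 2ℚ : ℚ
  ½  = frac 1 2
  2ℚ = frac 2 1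

-- For q ≤ ½ each term qᵏ/k! is at most (½)ᵏ, so the partial sums stay below 2 - 2·(½)ᵏ.
expPartial+tail≤2 : ∀ q k → 0ℚ ℚ.≤ q → q ℚ.≤ ½ → expPartial q k ℚ.+ 2ℚ ℚ.* (½ ^ℚ k) ℚ.≤ 2ℚ
expPartial+tail≤2 q zero    _   _   = ℚ.≤-refl
expPartial+tail≤2 q (suc k) 0≤q q≤½ = ℚ.≤-trans
  (ℚ.+-monoˡ-≤ (2ℚ ℚ.* (½ ℚ.* ½ ^ℚ k)) (ℚ.+-monoʳ-≤ (expPartial q k) term≤))
  (ℚ.≤-trans (ℚ.≤-reflexive (halve (expPartial q k) (½ ^ℚ k))) (expPartial+tail≤2 q k 0≤q q≤½))
  where
  term≤ : frac 1 (k !) ℚ.* (q ^ℚ k) ℚ.≤ ½ ^ℚ k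
  term≤ = ℚ.≤-trans (ℚ.*-monoˡ-≤-nonNeg (frac 1 (k !)) {{ℚ.nonNegative (0≤frac 1 (k !))}} (^ℚ-monoˡ-≤ k 0≤q q≤½))
    (ℚ.≤-trans (ℚ.*-monoʳ-≤-nonNeg (½ ^ℚ k) {{ℚ.nonNegative (0≤^ℚ ½ k (0≤frac 1 2))}} (frac1≤1 (k !)))
               (ℚ.≤-reflexive (ℚ.*-identityˡ _)))
  halve : ∀ x y → x ℚ.+ y ℚ.+ 2ℚ ℚ.* (½ ℚ.* y) ≡ x ℚ.+ 2ℚ ℚ.* y
  halve = solve 2 (λ x y → x :+ y :+ con 2ℚ :* (con ½ :* y) := x :+ con 2ℚ :* y) refl
    where open ℚ-Solver.+-*-Solver

expPartial≤2 : ∀ q k → 0ℚ ℚ.≤ q → q ℚ.≤ ½ → expPartial q k ℚ.≤ 2ℚ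
expPartial≤2 q k 0≤q q≤½ = ℚ.≤-trans
  (ℚ.≤-trans (ℚ.≤-reflexive (sym (ℚ.+-identityʳ _))) (ℚ.+-monoʳ-≤ (expPartial q k) 0≤tail))
  (expPartial+tail≤2 q k 0≤q q≤½)
  where
  0≤tail : 0ℚ ℚ.≤ 2ℚ ℚ.* (½ ^ℚ k)
  0≤tail = subst (ℚ._≤ 2ℚ ℚ.* (½ ^ℚ k)) (ℚ.*-zeroʳ 2ℚ)
    (ℚ.*-monoˡ-≤-nonNeg 2ℚ {{ℚ.nonNegative (0≤frac 2 1)}} (0≤^ℚ ½ k (0≤frac 1 2)))

2≤r³ : ∀ r → 2 ≤ r → 2 ≤ r ^ 3
2≤r³ r r≥2 = ≤-trans (s≤s (s≤s z≤n)) (^-monoˡ-≤ 3 r≥2)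

-- If q ≤ ½ then exp q ≤ 2 ≤ r³; if q > ½ then d·r³·q ≥ 2, so (d·r³·q)^K ≥ 2^K ≥ N and the premise fails.
≤2^expo⇒BoundedBy : ∀ d r N → 2 ≤ d → 2 ≤ r → N ≤ 2 ^ expo d r → BoundedBy 1 d r N
≤2^expo⇒BoundedBy d r N d≥2 r≥2 N≤2^K q 0≤q premise k with q ℚ.≤? ½
... | yes q≤½ = ℚ.≤-trans (expPartial≤2 q k 0≤q q≤½) (frac-≤ 2 0 (r ^ 3) 0 (*-monoˡ-≤ 1 (2≤r³ r r≥2)))
... | no  q≰½ = ⊥-elim (ℚ.<-irrefl refl (ℚ.<-≤-trans premise N≤base^K))
  where
  K D : ℕ
  K = expo d r
  D = d * r ^ 3
  2≤base : 2ℚ ℚ.≤ frac D 1 ℚ.* q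
  2≤base = ℚ.≤-trans
    (frac-≤ 2 0 (D * 1) 1 (≤-trans (*-mono-≤ d≥2 (2≤r³ r r≥2)) (≤-reflexive (sym (trans (*-identityʳ _) (*-identityʳ D))))))
    (ℚ.≤-trans (ℚ.≤-reflexive (sym (frac-* D 0 1 1)))
               (ℚ.*-monoˡ-≤-nonNeg (frac D 1) {{ℚ.nonNegative (0≤frac D 1)}} (ℚ.<⇒≤ (ℚ.≰⇒> q≰½))))
  N≤base^K : frac N 1 ℚ.≤ frac 1 1 ℚ.* ((frac D 1 ℚ.* q) ^ℚ K)
  N≤base^K = ℚ.≤-trans (frac-≤ N 0 (2 ^ K) 0 (*-monoˡ-≤ 1 N≤2^K))
    (ℚ.≤-trans (ℚ.≤-reflexive (sym (frac^ℚ 2 K)))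
    (ℚ.≤-trans (^ℚ-monoˡ-≤ K (0≤frac 2 1) 2≤base)
               (ℚ.≤-reflexive (sym (ℚ.*-identityˡ _)))))

regular-partition : ∀ {n m : ℕ} (E : Rel n m) (d r : ℕ) → 2 ≤ d → 2 ≤ r → VCDim≤ E d →
  Σ (Partition n) λ PX → Σ (Partition m) λ PY →
    RegularPartition (frac 1 r) E PX PY × BoundedBy 1 d r (size PX PY)
regular-partition E d (suc r) d≥2 r≥2 (vcX , vcY) =
  Rows.netPartition , Columns.netPartition , regular , bounded
  where
  t : ℕ
  t = 2 * suc r ^ 3 * 3 * suc r
  module Rows    = Clusters E t
  module Columns = Clusters (transposeRel E) t
  open SampleSize t d using (s; B≤2^[e*suc-d]; sample-large-enough)
  t≥1 : 1 ≤ t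
  t≥1 = 1≤* {2 * suc r ^ 3 * 3} (1≤* {2 * suc r ^ 3} (1≤* {2} (s≤s z≤n) (m^n>0 (suc r) 3)) (s≤s z≤n)) (s≤s z≤n)
    where
    1≤* : ∀ {a b} → 1 ≤ a → 1 ≤ b → 1 ≤ a * b
    1≤* = *-mono-≤
  regular : RegularPartition (frac 1 (suc r)) E Rows.netPartition Columns.netPartition
  regular = ClusterRegularity.regular E r t Rows.netPartition Columns.netPartition
    Rows.centre Columns.centre Rows.centre-close Columns.centre-close ≤-refl
  bounded : BoundedBy 1 d (suc r) (size Rows.netPartition Columns.netPartition)
  bounded = ≤2^expo⇒BoundedBy d (suc r) _ d≥2 r≥2 (begin
    size Rows.netPartition Columns.netPartition
      ≤⟨ ⊔-lub (Rows.#clusters≤ d s vcX (sample-large-enough t≥1))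
               (Columns.#clusters≤ d s vcY (sample-large-enough t≥1)) ⟩
    suc s ^ suc d                     ≤⟨ B≤2^[e*suc-d] t≥1 ⟩
    2 ^ (SampleSize.e t d * suc d)    ≤⟨ ^-monoʳ-≤ 2 (exponent-bound (suc r) d (s≤s z≤n) d≥2) ⟩
    2 ^ expo d (suc r)                ∎)
    where open ≤-Reasoning

mainTheorem3 : ∃[ C ] (∀ {n m : ℕ} (E : Rel n m) (d r : ℕ) → 2 ≤ d → 2 ≤ r →
    VCDim≤ E d →
    Σ (Partition n) λ PX → Σ (Partition m) λ PY →
    RegularPartition (frac 1 r) E PX PY × BoundedBy C d r (size PX PY))
mainTheorem3 = 1 , regular-partition
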